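{- (1) A transfer operator maps Roman graded sequences to Roman graded sequences: if $\tau$ is the transfer operator of a Roman graded sequence and $(q_a^\alpha(x))$ is a Roman graded sequence, then $(\tau q_a^\alpha(x))$ is a Roman graded sequence. (2) If $\tau$ is a continuous linear operator with $\tau p_a^\alpha(x)=q_a^\alpha(x)$ for all $a,\alpha$, where $(p_a^\alpha)$ and $(q_a^\alpha)$ are the associated graded sequences of the delta operators $f(D)$ and $g(D)$ respectively, then $\tau^*g(D)=f(D)$. (3) Moreover, such an operator $\tau$ is a transfer operator.
   Context: Setting (discrete case of the logarithmic umbral calculus). For $a\in\mathbb{Z}$ let $\lfloor a\rceil=a$ if $a\neq0$ and $\lfloor 0\rceil=1$; let $\lfloor a\rceil!=a!$ for $a\ge0$ and $\lfloor a\rceil!=(-1)^{ -a-1}/(-a-1)!$ for $a<0$. The harmonic logarithms $\lambda_a^\alpha(x)$ are indexed by $a\in\mathbb{Z}$ and a logarithmic index $\alpha$: $\lambda_a^{(0)}(x)=x^a$ for $a\ge0$, $0$ for $a<0$; $\lambda_a^{(1)}(x)=x^a(\log x-H_a)$ for $a\ge0$, $x^a$ for $a<0$ ($H_a$ the harmonic number); further indices involve iterated logarithms. $\mathcal{I}^\alpha$ is the space of formal series $\sum_{b\le N}c_b\lambda_b^\alpha$ with coefficientwise topology (degrees bounded above); $\mathcal{I}$ is spanned by all $\mathcal{I}^\alpha$. $D\lambda_a^\alpha=\lfloor a\rceil\lambda_{a-1}^\alpha$. Artinian operators are formal Laurent series $f(D)=\sum_{a\ge k}c_aD^a$ acting via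 $D^b\lambda_a^\alpha=\frac{\lfloor a\rceil!}{\lfloor a-b\rceil!}\lambda_{a-b}^\alpha$; they form the field $\Lambda^+$; a delta operator is one of degree $1$ (i.e. $\sum_{a\ge1}c_aD^a$ with $c_1\ne0$). $\langle\alpha\mid p\rangle$ is the coefficient of $\lambda_0^\alpha$ in $p\in\mathcal{I}^\alpha$. A graded sequence is a regular family $(p_a^\alpha)$, $p_a^\alpha\in\mathcal{I}^\alpha$ of degree $a$ (regular: coefficient of $\lambda_b^\alpha$ in $p_a^\alpha$ independent of $\alpha\ne(0)$, and $p_a^{(0)}$ obtained from $p_a^{(1)}$ by replacing $\lambda_b^{(1)}$ with $\lambda_b^{(0)}$). The associated graded sequence of a delta operator $f(D)$ is the unique graded sequence with $\langle\alpha\mid p_0^\alpha\rangle=1$, $\langle\alpha\mid p_a^\alpha\rangle=0$ ($a\ne0$), $f(D)p_a^\alpha=\lfloor a\rceil p_{a-1}^\alpha$. A Roman graded sequence is the associated graded sequence of some delta operator. The transfer operator of a Roman graded sequence $(p_a^\alpha)$ is the continuous linear operator with $\lambda_a^\alpha\mapsto p_a^\alpha$ for all $a,\alpha$. The adjoint $\theta^*:\Lambda^+\to\Lambda^+$ of a continuous linear regular operator $\theta$ is defined by $\langle\alpha\mid(\theta^*f)(D)p\rangle=\langle\alpha\mid f(D)\theta p\rangle$ for all $\alpha\ne(0)$, $p\in\mathcal{I}^\alpha$, $f\in\Lambda^+$. -}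

module Defs where

open import Level using (Level; _⊔_) renaming (suc to lsuc)
open import Algebra.Bundles using (CommutativeRing)
open import Data.Bool using (Bool; true; false; _∧_; not; if_then_else_)
open import Data.Nat as ℕ using (ℕ; zero; suc; _!)
import Data.Nat.Properties as ℕP
open import Data.Integer as ℤ using (ℤ; +_; -[1+_]; 0ℤ; 1ℤ)
import Data.Integer.Properties
open import Data.Integer.Properties using (_≤?_; _<?_; _≟_)
open import Data.Product using (Σ; _×_; _,_)
open import Relation.Nullary using (¬_; does)
open import Relation.Nullary.Decidable using (dec-true; dec-false)
open import Relation.Binary.PropositionalEquality using (_≡_; refl)

module RingNat {c ℓ} (R : CommutativeRing c ℓ) where
  open CommutativeRing R
  fromℕ : ℕ → Carrier
  fromℕ zero    = 0#
  fromℕ (suc n) = 1# + fromℕ n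

record Char0Field c ℓ : Set (lsuc (c ⊔ ℓ)) where
  field
    commRing : CommutativeRing c ℓ
  open CommutativeRing commRing renaming (refl to ≈-refl)
  open RingNat commRing
  field
    inv        : (x : Carrier) → ¬ (x ≈ 0#) → Carrier
    inv-cancel : ∀ x (nz : ¬ (x ≈ 0#)) → (x * inv x nz) ≈ 1#
    char0      : ∀ n → ¬ (fromℕ (suc n) ≈ 0#)

-- Logarithmic indices: integer sequences with finite support.
-- (0) is the zero sequence, (1) = (1,0,0,...).

record LogIndex : Set where
  field
    idx     : ℕ → ℤ
    supp    : ℕ
    finSupp : ∀ i → supp ℕ.≤ i → idx i ≡ 0ℤ
open LogIndex public

IsZeroIdx : LogIndex → Set
IsZeroIdx α = ∀ i → idx α i ≡ 0ℤ

zeroIdx : LogIndex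
zeroIdx = record { idx = λ _ → 0ℤ ; supp = 0 ; finSupp = λ _ _ → refl }

oneIdx : LogIndex
oneIdx = record { idx = f ; supp = 1 ; finSupp = fs }
  where
  f : ℕ → ℤ
  f zero    = 1ℤ
  f (suc _) = 0ℤ
  fs : ∀ i → 1 ℕ.≤ i → f i ≡ 0ℤ
  fs (suc i) _ = refl

isZeroℤ : ℤ → Bool
isZeroℤ (+ zero) = true
isZeroℤ _        = false

allZero : ℕ → (ℕ → ℤ) → Bool
allZero zero    f = true
allZero (suc n) f = isZeroℤ (f n) ∧ allZero n f

isZeroB : LogIndex → Bool
isZeroB α = allZero (supp α) (idx α)

allZero-true : ∀ n (f : ℕ → ℤ) → (∀ i → f i ≡ 0ℤ) → allZero n f ≡ true
allZero-true zero    f z = refl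
allZero-true (suc n) f z with f n | z n
... | .(+ zero) | refl = allZero-true n f z

isZeroB-true : ∀ α → IsZeroIdx α → isZeroB α ≡ true
isZeroB-true α z = allZero-true (supp α) (idx α) z

module Theory {c ℓ} (F : Char0Field c ℓ) where
  open Char0Field F
  open CommutativeRing commRing renaming (refl to ≈-refl)
  open RingNat commRing public

  K : Set c
  K = Carrier

  fromℤ : ℤ → K
  fromℤ (+ n)    = fromℕ n
  fromℤ -[1+ n ] = - fromℕ (suc n)

  ⌊_⌉ : ℤ → ℤ
  ⌊ + zero ⌉ = 1ℤ
  ⌊ a ⌉      = a

  negOnePow : ℕ → K
  negOnePow zero    = 1#
  negOnePow (suc n) = - (negOnePow n)

  fact-nz : ∀ n → ¬ (fromℕ (n !) ≈ 0#)
  fact-nz n with n ! | ℕP.1≤n! n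
  ... | suc k | _ = char0 k

  fact : ℤ → K
  fact (+ n)    = fromℕ (n !)
  fact -[1+ n ] = negOnePow n * inv (fromℕ (n !)) (fact-nz n)

  invFact : ℤ → K
  invFact (+ n)    = inv (fromℕ (n !)) (fact-nz n)
  invFact -[1+ n ] = negOnePow n * fromℕ (n !)

  -- D^b λ_a = (⌊a⌉! / ⌊a-b⌉!) λ_{a-b};  this is the scalar ⌊a⌉!/⌊a-b⌉!
  ratio : ℤ → ℤ → K
  ratio a b = fact a * invFact (a ℤ.- b)

  sumFrom : ℤ → ℕ → (ℤ → K) → K
  sumFrom lo zero    f = 0#
  sumFrom lo (suc n) f = f lo + sumFrom (lo ℤ.+ 1ℤ) n f

  rangeSum : ℤ → ℤ → (ℤ → K) → K
  rangeSum lo hi f = if does (lo ≤? hi) then sumFrom lo (suc ℤ.∣ hi ℤ.- lo ∣) f else 0#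

  -- Elements of I^α: formal series Σ_{b ≤ N} c_b λ_b^α, stored by their
  -- coefficient functions.  Since λ_b^(0) = 0 for b < 0, an element of
  -- I^(0) has vanishing coefficients at negative b.

  record Ser (α : LogIndex) : Set (c ⊔ ℓ) where
    field
      coef    : ℤ → K
      bound   : ℤ
      vanish  : ∀ b → bound ℤ.< b → coef b ≈ 0#
      zeroNeg : IsZeroIdx α → ∀ b → b ℤ.< 0ℤ → coef b ≈ 0#
  open Ser public

  sel : Bool → K → K
  sel true  x = x
  sel false x = 0#

  sel-0 : ∀ b → sel b 0# ≈ 0#
  sel-0 true  = ≈-refl
  sel-0 false = ≈-refl

  mkSer : (α : LogIndex) → ℤ → (ℤ → K) → Ser α
  mkSer α N g = record
    { coef    = co
    ; bound   = N
    ; vanish  = van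
    ; zeroNeg = zn
    }
    where
    co : ℤ → K
    co b = sel (does (b ≤? N)) (sel (not (isZeroB α ∧ does (b <? 0ℤ))) (g b))
    van : ∀ b → N ℤ.< b → co b ≈ 0#
    van b N<b rewrite dec-false (b ≤? N) (Data.Integer.Properties.<⇒≱ N<b) = ≈-refl
    zn : IsZeroIdx α → ∀ b → b ℤ.< 0ℤ → co b ≈ 0#
    zn z b b<0 rewrite isZeroB-true α z | dec-true (b <? 0ℤ) b<0 = sel-0 (does (b ≤? N))

  _≈S_ : ∀ {α} → Ser α → Ser α → Set ℓ
  s ≈S t = ∀ b → coef s b ≈ coef t b

  _+S_ : ∀ {α} → Ser α → Ser α → Ser α
  _+S_ {α} s t = mkSer α (bound s ℤ.⊔ bound t) (λ b → coef s b + coef t b)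

  _·S_ : ∀ {α} → K → Ser α → Ser α
  _·S_ {α} k s = mkSer α (bound s) (λ b → k * coef s b)

  λ[_,_] : ℤ → (α : LogIndex) → Ser α
  λ[ a , α ] = mkSer α a (λ b → if does (b ≟ a) then 1# else 0#)

  ⟨_∣_⟩ : (α : LogIndex) → Ser α → K
  ⟨ α ∣ p ⟩ = coef p 0ℤ

  record Artinian : Set (c ⊔ ℓ) where
    field
      dcoef : ℤ → K
      low   : ℤ
      below : ∀ a → a ℤ.< low → dcoef a ≈ 0#
  open Artinian public

  record Delta : Set (c ⊔ ℓ) where
    field
      op     : Artinian
      deg≥1  : ∀ a → a ℤ.< 1ℤ → dcoef op a ≈ 0#
      c₁≠0   : ¬ (dcoef op 1ℤ ≈ 0#)
  open Delta public

  act : ∀ {α} → Artinian → Ser α → Ser α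
  act {α} f s = mkSer α (bound s ℤ.- low f)
    (λ c → rangeSum (low f) (bound s ℤ.- c)
             (λ a → dcoef f a * (coef s (c ℤ.+ a) * ratio (c ℤ.+ a) a)))

  Op : Set (c ⊔ ℓ)
  Op = (α : LogIndex) → Ser α → Ser α

  Linear : Op → Set (c ⊔ ℓ)
  Linear T = ∀ α →
      (∀ s t → s ≈S t → T α s ≈S T α t)
    × (∀ s t → T α (s +S t) ≈S (T α s +S T α t))
    × (∀ k s → T α (k ·S s) ≈S (k ·S T α s))

  Converges : ∀ {α} → (ℕ → Ser α) → Ser α → Set ℓ
  Converges u s =
      Σ ℤ (λ N → ∀ n b → N ℤ.< b → coef (u n) b ≈ 0#)
    × (∀ b → Σ ℕ (λ n₀ → ∀ n → n₀ ℕ.≤ n → coef (u n) b ≈ coef s b))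

  Continuous : Op → Set (c ⊔ ℓ)
  Continuous T = ∀ α (u : ℕ → Ser α) (s : Ser α) →
    Converges u s → Converges (λ n → T α (u n)) (T α s)

  GSeq : Set (c ⊔ ℓ)
  GSeq = (a : ℤ) → (α : LogIndex) → Ser α

  IsGraded : GSeq → Set ℓ
  IsGraded p =
      (∀ a α → ¬ IsZeroIdx α → ¬ (coef (p a α) a ≈ 0#))
    × (∀ a α → ¬ IsZeroIdx α → ∀ b → a ℤ.< b → coef (p a α) b ≈ 0#)
    × (∀ a α β → ¬ IsZeroIdx α → ¬ IsZeroIdx β → ∀ b → coef (p a α) b ≈ coef (p a β) b)
    × (∀ a b → 0ℤ ℤ.≤ b → coef (p a zeroIdx) b ≈ coef (p a oneIdx) b)

  IsAssociated : Delta → GSeq → Set ℓ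
  IsAssociated f p =
      IsGraded p
    × (∀ α → ⟨ α ∣ p 0ℤ α ⟩ ≈ 1#)
    × (∀ a α → ¬ (a ≡ 0ℤ) → ⟨ α ∣ p a α ⟩ ≈ 0#)
    × (∀ a α → act (op f) (p a α) ≈S (fromℤ ⌊ a ⌉ ·S p (a ℤ.- 1ℤ) α))

  Roman : GSeq → Set (c ⊔ ℓ)
  Roman p = Σ Delta (λ f → IsAssociated f p)

  IsTransferOf : GSeq → Op → Set (c ⊔ ℓ)
  IsTransferOf p τ =
    Continuous τ × Linear τ × (∀ a α → τ α λ[ a , α ] ≈S p a α)

  IsTransferOperator : Op → Set (c ⊔ ℓ)
  IsTransferOperator τ = Σ GSeq (λ p → Roman p × IsTransferOf p τ)

  -- (τ* g)(D) = f(D), unfolding the definition of the adjoint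
  AdjointIs : Op → Artinian → Artinian → Set (c ⊔ ℓ)
  AdjointIs τ g f = ∀ α → ¬ IsZeroIdx α → ∀ (s : Ser α) →
    ⟨ α ∣ act f s ⟩ ≈ ⟨ α ∣ act g (τ α s) ⟩

-- Everything is computed with coefficient matrices. A graded sequence p gives, for each α, the
-- lower-triangular matrix P (row b = coefficients of p_b^α), and a series φ(D) acts on coefficient
-- rows as the matrix Φ b c = φ_{b−c} ⌊b⌉!/⌊c⌉!, turning composition of series into power series of
-- matrices. Being associated to f means P·F = D·P together with column 0 of P being that of the
-- identity; a continuous linear operator is determined by its matrix on any triangular basis.
-- (1) If τλ_a = p_a (p associated to f), then τq_a has matrix Q·P, and P·F = D·P gives
-- P·g(F) = g(D)·P = G·P, so Q·P intertwines g(f(D)) with D: τq is associated to g(f(D)).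
-- (2) If τp_a = q_a, then τ has matrix T = P⁻¹·Q with T·G = F·T and column 0 of T that of the
-- identity, which pairs ⟨α ∣ g(D) τs⟩ with ⟨α ∣ f(D) s⟩. (3) The same T intertwines f̄(g(D)) with D,
-- f̄ the compositional inverse of f, so (τλ_a) is associated to f̄(g(D)) and τ is its transfer operator.

module Submission where

open import Defs
open import Algebra.Bundles using (CommutativeRing; Semiring)
open import Data.Bool using (Bool; true; false; if_then_else_; _∧_; not)
open import Data.Empty using (⊥; ⊥-elim)
open import Data.Integer as ℤ using (ℤ; +_; -[1+_]; 0ℤ; 1ℤ; -1ℤ)
import Data.Integer.Properties as ℤP
open import Data.Integer.Tactic.RingSolver using (solve-∀)
open import Data.Nat as ℕ using (ℕ; zero; suc; _!)
import Data.Nat.Properties as ℕP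
open import Data.Product using (_×_; _,_; proj₁; proj₂)
open import Data.Sum using (_⊎_; inj₁; inj₂)
open import Data.Unit using (⊤; tt)
open import Relation.Nullary using (¬_; yes; no; does; Dec)
open import Relation.Nullary.Decidable using (dec-true; dec-false)
open import Relation.Binary.PropositionalEquality as P using (_≡_; _≢_)
open import Relation.Binary.Bundles using (Setoid)
import Relation.Binary.Reasoning.Setoid

infixl 6 _+1 _−1

_+1 : ℤ → ℤ
i +1 = i ℤ.+ 1ℤ

_−1 : ℤ → ℤ
i −1 = i ℤ.- 1ℤ

[i−1]+1≡i : ∀ i → (i ℤ.- 1ℤ) ℤ.+ 1ℤ ≡ i
[i−1]+1≡i = solve-∀

[i+1]−1≡i : ∀ i → (i ℤ.+ 1ℤ) ℤ.- 1ℤ ≡ i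
[i+1]−1≡i = solve-∀

i+[j−i]≡j : ∀ i j → i ℤ.+ (j ℤ.- i) ≡ j
i+[j−i]≡j = solve-∀

i−[i−j]≡j : ∀ i j → i ℤ.- (i ℤ.- j) ≡ j
i−[i−j]≡j = solve-∀

[i+j]−i≡j : ∀ i j → (i ℤ.+ j) ℤ.- i ≡ j
[i+j]−i≡j = solve-∀

[i−[j+1]]+1≡i−j : ∀ i j → (i ℤ.- (j ℤ.+ 1ℤ)) ℤ.+ 1ℤ ≡ i ℤ.- j
[i−[j+1]]+1≡i−j = solve-∀

i−[j+1]≡-1+[i−j] : ∀ i j → i ℤ.- (j ℤ.+ 1ℤ) ≡ -1ℤ ℤ.+ (i ℤ.- j)
i−[j+1]≡-1+[i−j] = solve-∀

i−[j+k]≡[i−j]−k : ∀ i j k → i ℤ.- (j ℤ.+ k) ≡ (i ℤ.- j) ℤ.- k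
i−[j+k]≡[i−j]−k = solve-∀

[i−j]+[j−k]≡i−k : ∀ i j k → (i ℤ.- j) ℤ.+ (j ℤ.- k) ≡ i ℤ.- k
[i−j]+[j−k]≡i−k = solve-∀

i−n−1≡i−[1+n] : ∀ i n → i ℤ.- + n −1 ≡ i ℤ.- + suc n
i−n−1≡i−[1+n] i n = P.trans (P.sym (i−[j+k]≡[i−j]−k i (+ n) 1ℤ)) (P.cong (λ x → i ℤ.- x) (ℤP.+-comm (+ n) 1ℤ))

i−j≡1⇒j≡i−1 : ∀ i j → i ℤ.- j ≡ 1ℤ → j ≡ i −1
i−j≡1⇒j≡i−1 i j i−j≡1 = P.trans (P.sym (i−[i−j]≡j i j)) (P.cong (λ k → i ℤ.- k) i−j≡1)

0<1 : 0ℤ ℤ.< 1ℤ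
0<1 = ℤ.+<+ (ℕ.s≤s ℕ.z≤n)

i<i+1 : ∀ i → i ℤ.< i +1
i<i+1 i = P.subst (ℤ._< i +1) (ℤP.+-identityʳ i) (ℤP.+-monoʳ-< i 0<1)

i−1<i : ∀ i → i −1 ℤ.< i
i−1<i i = P.subst (i −1 ℤ.<_) ([i−1]+1≡i i) (i<i+1 (i −1))

<⇒+1≤ : ∀ {i j} → i ℤ.< j → i +1 ℤ.≤ j
<⇒+1≤ {i} {j} i<j = P.subst (ℤ._≤ j) (ℤP.+-comm 1ℤ i) (ℤP.i<j⇒suc[i]≤j i<j)

≤⇒<+1 : ∀ {i j} → i ℤ.≤ j → i ℤ.< j +1
≤⇒<+1 {j = j} i≤j = ℤP.≤-<-trans i≤j (i<i+1 j)

≤⇒≤+1 : ∀ {i j} → i ℤ.≤ j → i ℤ.≤ j +1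
≤⇒≤+1 i≤j = ℤP.<⇒≤ (≤⇒<+1 i≤j)

<+1⇒≤ : ∀ {i j} → i ℤ.< j +1 → i ℤ.≤ j
<+1⇒≤ i<j+1 = ℤP.≮⇒≥ (λ j<i → ℤP.<-irrefl P.refl (ℤP.<-≤-trans i<j+1 (<⇒+1≤ j<i)))

i−j<k⇒i−k<j : ∀ i j k → i ℤ.- j ℤ.< k → i ℤ.- k ℤ.< j
i−j<k⇒i−k<j i j k i−j<k = P.subst₂ ℤ._<_ ([i−j]+[j−k]≡i−k i j k) (i+[j−i]≡j k j) (ℤP.+-monoˡ-< (j ℤ.- k) i−j<k)

≤-or-> : ∀ i j → i ℤ.≤ j ⊎ j ℤ.< i
≤-or-> i j with i ℤP.≤? j
... | yes i≤j = inj₁ i≤j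
... | no i≰j  = inj₂ (ℤP.≰⇒> i≰j)

data Above (lo : ℤ) : ℤ → Set where
  lo+_ : ∀ n → Above lo (lo ℤ.+ + n)

above : ∀ {lo hi} → lo ℤ.≤ hi → Above lo hi
above {lo} {hi} lo≤hi = P.subst (Above lo) eq (lo+ ℤ.∣ hi ℤ.- lo ∣)
  where
  eq : lo ℤ.+ + ℤ.∣ hi ℤ.- lo ∣ ≡ hi
  eq = P.trans (P.cong (λ x → lo ℤ.+ x) (ℤP.0≤i⇒+∣i∣≡i (ℤP.i≤j⇒0≤j-i lo≤hi))) (i+[j−i]≡j lo hi)

lo+n+1≡lo+[1+n] : ∀ lo n → lo ℤ.+ + n +1 ≡ lo ℤ.+ + suc n
lo+n+1≡lo+[1+n] lo n = P.trans (ℤP.+-assoc lo (+ n) 1ℤ) (P.cong (λ x → lo ℤ.+ x) (ℤP.+-comm (+ n) 1ℤ))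

≤-induction : ∀ {q} (lo : ℤ) (Q : ℤ → Set q) → Q lo → (∀ h → lo ℤ.≤ h → Q h → Q (h +1)) →
  ∀ h → lo ℤ.≤ h → Q h
≤-induction lo Q base step h lo≤h with above lo≤h
... | lo+ n = go n
  where
  go : ∀ n → Q (lo ℤ.+ + n)
  go zero    = P.subst Q (P.sym (ℤP.+-identityʳ lo)) base
  go (suc n) = P.subst Q (lo+n+1≡lo+[1+n] lo n) (step (lo ℤ.+ + n) (ℤP.i≤i+j lo (+ n)) (go n))

≥-induction : ∀ {q} (hi : ℤ) (Q : ℤ → Set q) → Q hi → (∀ k → k ℤ.< hi → Q (k +1) → Q k) →
  ∀ k → k ℤ.≤ hi → Q k
≥-induction hi Q base step k k≤hi = P.subst Q (i−[i−j]≡j hi k)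
  (≤-induction 0ℤ (λ t → Q (hi ℤ.- t)) (P.subst Q (P.sym (ℤP.+-identityʳ hi)) base)
    (λ t 0≤t Q[hi−t] → step (hi ℤ.- (t +1)) (below t 0≤t) (P.subst Q (P.sym ([i−[j+1]]+1≡i−j hi t)) Q[hi−t]))
    (hi ℤ.- k) (ℤP.i≤j⇒0≤j-i k≤hi))
  where
  below : ∀ t → 0ℤ ℤ.≤ t → hi ℤ.- (t +1) ℤ.< hi
  below t 0≤t = ℤP.<-≤-trans (ℤP.+-monoʳ-< hi (ℤP.neg-mono-< (ℤP.≤-<-trans 0≤t (i<i+1 t))))
                             (ℤP.≤-reflexive (ℤP.+-identityʳ hi))

range-induction : ∀ {q} (lo : ℤ) (Q : ℤ → Set q) → (∀ h → h ℤ.< lo → Q h) →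
  (∀ h → lo ℤ.≤ h +1 → Q h → Q (h +1)) → ∀ h → Q h
range-induction lo Q empty step h with ≤-or-> lo h
... | inj₂ h<lo = empty h h<lo
... | inj₁ lo≤h = ≤-induction (lo −1) Q (empty (lo −1) (i−1<i lo))
  (λ k lo−1≤k → step k (P.subst (ℤ._≤ k +1) ([i−1]+1≡i lo) (ℤP.+-monoˡ-≤ 1ℤ lo−1≤k)))
  h (ℤP.≤-trans (ℤP.<⇒≤ (i−1<i lo)) lo≤h)

module _ {c ℓ} (F : Char0Field c ℓ) where

  open Char0Field F
  open CommutativeRing commRing renaming (refl to ≈-refl; sym to ≈-sym; trans to ≈-trans)
  open Theory F
  open import Algebra.Definitions.RawSemiring (Semiring.rawSemiring semiring) using (_^_)
  open Relation.Binary.Reasoning.Setoid setoid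
  open import Algebra.Properties.Ring ring using (-‿distribˡ-*; -‿distribʳ-*; -‿involutive; -1*x≈-x; [y-z]x≈yx-zx)
  open import Algebra.Properties.Group +-group using (//-rightDividesˡ; x∙y⁻¹≈ε⇒x≈y)
  open import Algebra.Properties.CommutativeSemigroup *-commutativeSemigroup
    using (x∙yz≈y∙xz) renaming (interchange to *-interchange)
  open import Algebra.Properties.CommutativeSemigroup +-commutativeSemigroup
    using () renaming (interchange to +-interchange)

  1≉0 : 1# ≉ 0#
  1≉0 1≈0 = char0 0 (≈-trans (+-identityʳ 1#) 1≈0)

  nonzero-cancelˡ : ∀ {x y} → x ≉ 0# → x * y ≈ 0# → y ≈ 0#
  nonzero-cancelˡ {x} {y} x≉0 xy≈0 = begin
    y                   ≈⟨ *-identityˡ y ⟨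
    1# * y              ≈⟨ *-congʳ (≈-trans (*-comm _ x) (inv-cancel x x≉0)) ⟨
    (inv x x≉0 * x) * y ≈⟨ *-assoc _ x y ⟩
    inv x x≉0 * (x * y) ≈⟨ *-congˡ xy≈0 ⟩
    inv x x≉0 * 0#      ≈⟨ zeroʳ _ ⟩
    0#                  ∎

  nonzero-cancelʳ : ∀ {x y} → y ≉ 0# → x * y ≈ 0# → x ≈ 0#
  nonzero-cancelʳ y≉0 xy≈0 = nonzero-cancelˡ y≉0 (≈-trans (*-comm _ _) xy≈0)

  *-nonzero : ∀ {x y} → x ≉ 0# → y ≉ 0# → x * y ≉ 0#
  *-nonzero x≉0 y≉0 xy≈0 = y≉0 (nonzero-cancelˡ x≉0 xy≈0)

  ≉0-resp : ∀ {x y} → x ≈ y → x ≉ 0# → y ≉ 0#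
  ≉0-resp x≈y x≉0 y≈0 = x≉0 (≈-trans x≈y y≈0)

  invertible⇒nonzeroˡ : ∀ {x y} → x * y ≈ 1# → x ≉ 0#
  invertible⇒nonzeroˡ {y = y} xy≈1 x≈0 = 1≉0 (≈-trans (≈-sym xy≈1) (≈-trans (*-congʳ x≈0) (zeroˡ y)))

  invertible⇒nonzeroʳ : ∀ {x y} → x * y ≈ 1# → y ≉ 0#
  invertible⇒nonzeroʳ xy≈1 = invertible⇒nonzeroˡ (≈-trans (*-comm _ _) xy≈1)

  fromℕ-+ : ∀ m n → fromℕ (m ℕ.+ n) ≈ fromℕ m + fromℕ n
  fromℕ-+ zero    n = ≈-sym (+-identityˡ _)
  fromℕ-+ (suc m) n = ≈-trans (+-congˡ (fromℕ-+ m n)) (≈-sym (+-assoc _ _ _))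

  fromℕ-* : ∀ m n → fromℕ (m ℕ.* n) ≈ fromℕ m * fromℕ n
  fromℕ-* zero    n = ≈-sym (zeroˡ _)
  fromℕ-* (suc m) n = begin
    fromℕ (n ℕ.+ m ℕ.* n)             ≈⟨ fromℕ-+ n (m ℕ.* n) ⟩
    fromℕ n + fromℕ (m ℕ.* n)         ≈⟨ +-cong (≈-sym (*-identityˡ _)) (fromℕ-* m n) ⟩
    1# * fromℕ n + fromℕ m * fromℕ n  ≈⟨ distribʳ _ _ _ ⟨
    (1# + fromℕ m) * fromℕ n          ∎

  negOnePow-square : ∀ n → negOnePow n * negOnePow n ≈ 1#
  negOnePow-square zero    = *-identityˡ 1#
  negOnePow-square (suc n) = begin
    - negOnePow n * - negOnePow n     ≈⟨ -‿distribˡ-* _ _ ⟨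
    - (negOnePow n * - negOnePow n)   ≈⟨ -‿cong (-‿distribʳ-* _ _) ⟨
    - - (negOnePow n * negOnePow n)   ≈⟨ -‿involutive _ ⟩
    negOnePow n * negOnePow n         ≈⟨ negOnePow-square n ⟩
    1#                                ∎

  fact*invFact : ∀ a → fact a * invFact a ≈ 1#
  fact*invFact (+ n)    = inv-cancel _ _
  fact*invFact -[1+ n ] = begin
    (negOnePow n * inv n! _) * (negOnePow n * n!) ≈⟨ *-interchange _ _ _ _ ⟩
    (negOnePow n * negOnePow n) * (inv n! _ * n!) ≈⟨ *-cong (negOnePow-square n) (≈-trans (*-comm _ _) (inv-cancel _ _)) ⟩
    1# * 1#                                       ≈⟨ *-identityˡ 1# ⟩
    1#                                            ∎
    where
    n! : Carrier
    n! = fromℕ (n !)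

  ratio-nonzero : ∀ a b → ratio a b ≉ 0#
  ratio-nonzero a b = *-nonzero (invertible⇒nonzeroˡ (fact*invFact a))
                                (invertible⇒nonzeroʳ (fact*invFact (a ℤ.- b)))

  factRatio-telescope : ∀ a b c → (fact a * invFact b) * (fact b * invFact c) ≈ fact a * invFact c
  factRatio-telescope a b c = begin
    (fact a * invFact b) * (fact b * invFact c) ≈⟨ *-assoc _ _ _ ⟩
    fact a * (invFact b * (fact b * invFact c)) ≈⟨ *-congˡ (*-assoc _ _ _) ⟨
    fact a * ((invFact b * fact b) * invFact c) ≈⟨ *-congˡ (*-congʳ (≈-trans (*-comm _ _) (fact*invFact b))) ⟩
    fact a * (1# * invFact c)                   ≈⟨ *-congˡ (*-identityˡ _) ⟩
    fact a * invFact c                          ∎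

  ratio-zero : ∀ a → ratio a 0ℤ ≈ 1#
  ratio-zero a rewrite ℤP.+-identityʳ a = fact*invFact a

  ratio-one : ∀ a → ratio a 1ℤ ≈ fromℤ ⌊ a ⌉
  ratio-one (+ zero) = begin
    (1# + 0#) * (1# * (1# + 0#)) ≈⟨ *-cong (+-identityʳ 1#) (≈-trans (*-identityˡ _) (+-identityʳ 1#)) ⟩
    1# * 1#                      ≈⟨ *-identityˡ 1# ⟩
    1#                           ≈⟨ +-identityʳ 1# ⟨
    1# + 0#                      ∎
  ratio-one (+ suc n) = begin
    fromℕ (suc n ℕ.* n !) * inv n! _   ≈⟨ *-congʳ (fromℕ-* (suc n) (n !)) ⟩
    (fromℕ (suc n) * n!) * inv n! _    ≈⟨ *-assoc _ _ _ ⟩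
    fromℕ (suc n) * (n! * inv n! _)    ≈⟨ *-congˡ (inv-cancel _ _) ⟩
    fromℕ (suc n) * 1#                 ≈⟨ *-identityʳ _ ⟩
    fromℕ (suc n)                      ∎
    where
    n! : Carrier
    n! = fromℕ (n !)
  ratio-one -[1+ n ] rewrite ℕP.+-identityʳ n = begin
    (s * i) * (- s * fromℕ (suc n ℕ.* n !))   ≈⟨ *-congˡ (*-congˡ (fromℕ-* (suc n) (n !))) ⟩
    (s * i) * (- s * (m * n!))                ≈⟨ *-congˡ (-‿distribˡ-* _ _) ⟨
    (s * i) * - (s * (m * n!))                ≈⟨ -‿distribʳ-* _ _ ⟨
    - ((s * i) * (s * (m * n!)))              ≈⟨ -‿cong (*-interchange _ _ _ _) ⟩
    - ((s * s) * (i * (m * n!)))              ≈⟨ -‿cong (*-cong (negOnePow-square n) (x∙yz≈y∙xz _ _ _)) ⟩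
    - (1# * (m * (i * n!)))                   ≈⟨ -‿cong (*-identityˡ _) ⟩
    - (m * (i * n!))                          ≈⟨ -‿cong (*-congˡ (≈-trans (*-comm _ _) (inv-cancel _ _))) ⟩
    - (m * 1#)                                ≈⟨ -‿cong (*-identityʳ m) ⟩
    - m                                       ∎
    where
    s n! i m : Carrier
    s = negOnePow n
    n! = fromℕ (n !)
    i = inv n! (fact-nz n)
    m = fromℕ (suc n)

  ratio-suc : ∀ b k → ratio b (+ k) * fromℤ ⌊ b ℤ.- + k ⌉ ≈ ratio b (+ suc k)
  ratio-suc b k = begin
    (fact b * invFact (b ℤ.- + k)) * fromℤ ⌊ b ℤ.- + k ⌉                    ≈⟨ *-congˡ (ratio-one (b ℤ.- + k)) ⟨
    (fact b * invFact (b ℤ.- + k)) * (fact (b ℤ.- + k) * invFact (b ℤ.- + k −1)) ≈⟨ factRatio-telescope b (b ℤ.- + k) (b ℤ.- + k −1) ⟩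
    fact b * invFact (b ℤ.- + k −1)                                         ≡⟨ P.cong (λ x → fact b * invFact x) (i−n−1≡i−[1+n] b k) ⟩
    ratio b (+ suc k)                                                       ∎

  -- Sums over integer ranges

  rangeSum-empty : ∀ {lo hi} f → hi ℤ.< lo → rangeSum lo hi f ≈ 0#
  rangeSum-empty {lo} {hi} f hi<lo rewrite dec-false (lo ℤP.≤? hi) (ℤP.<⇒≱ hi<lo) = ≈-refl

  sumFrom-snoc : ∀ lo n f → sumFrom lo (suc n) f ≈ sumFrom lo n f + f (lo ℤ.+ + n)
  sumFrom-snoc lo zero f = begin
    f lo + 0#            ≈⟨ +-comm _ _ ⟩
    0# + f lo            ≡⟨ P.cong (λ i → 0# + f i) (ℤP.+-identityʳ lo) ⟨
    0# + f (lo ℤ.+ + 0)  ∎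
  sumFrom-snoc lo (suc n) f = begin
    f lo + sumFrom (lo +1) (suc n) f            ≈⟨ +-congˡ (sumFrom-snoc (lo +1) n f) ⟩
    f lo + (sumFrom (lo +1) n f + f (lo +1 ℤ.+ + n)) ≈⟨ +-assoc _ _ _ ⟨
    sumFrom lo (suc n) f + f (lo +1 ℤ.+ + n)     ≡⟨ P.cong (λ i → sumFrom lo (suc n) f + f i) (ℤP.+-assoc lo 1ℤ (+ n)) ⟩
    sumFrom lo (suc n) f + f (lo ℤ.+ + suc n)    ∎

  rangeSum-sumFrom : ∀ lo n f → rangeSum lo (lo ℤ.+ + n) f ≡ sumFrom lo (suc n) f
  rangeSum-sumFrom lo n f
    rewrite dec-true (lo ℤP.≤? lo ℤ.+ + n) (ℤP.i≤i+j lo (+ n)) | [i+j]−i≡j lo (+ n) = P.refl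

  rangeSum-single : ∀ a f → rangeSum a a f ≈ f a
  rangeSum-single a f rewrite dec-true (a ℤP.≤? a) ℤP.≤-refl | ℤP.+-inverseʳ a = +-identityʳ _

  rangeSum-snoc : ∀ {lo hi} f → lo ℤ.≤ hi +1 → rangeSum lo (hi +1) f ≈ rangeSum lo hi f + f (hi +1)
  rangeSum-snoc {lo} {hi} f lo≤hi+1 = by-cases (≤-or-> lo hi)
    where
    nonempty : ∀ {hi} → Above lo hi → rangeSum lo (hi +1) f ≈ rangeSum lo hi f + f (hi +1)
    nonempty (lo+ n) = begin
      rangeSum lo (lo ℤ.+ + n +1) f             ≡⟨ P.cong (λ h → rangeSum lo h f) (lo+n+1≡lo+[1+n] lo n) ⟩
      rangeSum lo (lo ℤ.+ + suc n) f            ≡⟨ rangeSum-sumFrom lo (suc n) f ⟩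
      sumFrom lo (suc (suc n)) f                ≈⟨ sumFrom-snoc lo (suc n) f ⟩
      sumFrom lo (suc n) f + f (lo ℤ.+ + suc n) ≡⟨ P.cong₂ (λ s i → s + f i) (rangeSum-sumFrom lo n f) (lo+n+1≡lo+[1+n] lo n) ⟨
      rangeSum lo (lo ℤ.+ + n) f + f (lo ℤ.+ + n +1) ∎
    by-cases : lo ℤ.≤ hi ⊎ hi ℤ.< lo → rangeSum lo (hi +1) f ≈ rangeSum lo hi f + f (hi +1)
    by-cases (inj₁ lo≤hi) = nonempty (above lo≤hi)
    by-cases (inj₂ hi<lo) rewrite P.sym (ℤP.≤-antisym lo≤hi+1 (<⇒+1≤ hi<lo)) = begin
      rangeSum lo lo f        ≈⟨ rangeSum-single lo f ⟩
      f lo                    ≈⟨ +-identityˡ _ ⟨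
      0# + f lo               ≈⟨ +-congʳ (rangeSum-empty f hi<lo) ⟨
      rangeSum lo hi f + f lo ∎

  rangeSum-cong-range : ∀ {lo} hi {f g : ℤ → Carrier} → (∀ i → lo ℤ.≤ i → i ℤ.≤ hi → f i ≈ g i) →
    rangeSum lo hi f ≈ rangeSum lo hi g
  rangeSum-cong-range {lo} hi {f} {g} = range-induction lo
    (λ h → (∀ i → lo ℤ.≤ i → i ℤ.≤ h → f i ≈ g i) → rangeSum lo h f ≈ rangeSum lo h g)
    (λ h h<lo _ → ≈-trans (rangeSum-empty f h<lo) (≈-sym (rangeSum-empty g h<lo)))
    (λ h lo≤h+1 ih f≈g → begin
      rangeSum lo (h +1) f       ≈⟨ rangeSum-snoc f lo≤h+1 ⟩
      rangeSum lo h f + f (h +1) ≈⟨ +-cong (ih (λ i lo≤i i≤h → f≈g i lo≤i (≤⇒≤+1 i≤h))) (f≈g (h +1) lo≤h+1 ℤP.≤-refl) ⟩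
      rangeSum lo h g + g (h +1) ≈⟨ rangeSum-snoc g lo≤h+1 ⟨
      rangeSum lo (h +1) g       ∎)
    hi

  rangeSum-cong : ∀ {lo} hi {f g : ℤ → Carrier} → (∀ i → f i ≈ g i) → rangeSum lo hi f ≈ rangeSum lo hi g
  rangeSum-cong hi f≈g = rangeSum-cong-range hi (λ i _ _ → f≈g i)

  rangeSum-+ : ∀ {lo} hi (f g : ℤ → Carrier) →
    rangeSum lo hi (λ i → f i + g i) ≈ rangeSum lo hi f + rangeSum lo hi g
  rangeSum-+ {lo} hi f g = range-induction lo
    (λ h → rangeSum lo h (λ i → f i + g i) ≈ rangeSum lo h f + rangeSum lo h g)
    (λ h h<lo → begin
      rangeSum lo h (λ i → f i + g i)   ≈⟨ rangeSum-empty _ h<lo ⟩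
      0#                                ≈⟨ +-identityˡ 0# ⟨
      0# + 0#                           ≈⟨ +-cong (rangeSum-empty f h<lo) (rangeSum-empty g h<lo) ⟨
      rangeSum lo h f + rangeSum lo h g ∎)
    (λ h lo≤h+1 ih → begin
      rangeSum lo (h +1) (λ i → f i + g i)                        ≈⟨ rangeSum-snoc _ lo≤h+1 ⟩
      rangeSum lo h (λ i → f i + g i) + (f (h +1) + g (h +1))     ≈⟨ +-congʳ ih ⟩
      (rangeSum lo h f + rangeSum lo h g) + (f (h +1) + g (h +1)) ≈⟨ +-interchange _ _ _ _ ⟩
      (rangeSum lo h f + f (h +1)) + (rangeSum lo h g + g (h +1)) ≈⟨ +-cong (rangeSum-snoc f lo≤h+1) (rangeSum-snoc g lo≤h+1) ⟨
      rangeSum lo (h +1) f + rangeSum lo (h +1) g                 ∎)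
    hi

  rangeSum-*ˡ : ∀ {lo} hi k (f : ℤ → Carrier) → k * rangeSum lo hi f ≈ rangeSum lo hi (λ i → k * f i)
  rangeSum-*ˡ {lo} hi k f = range-induction lo
    (λ h → k * rangeSum lo h f ≈ rangeSum lo h (λ i → k * f i))
    (λ h h<lo → ≈-trans (*-congˡ (rangeSum-empty f h<lo)) (≈-trans (zeroʳ k) (≈-sym (rangeSum-empty _ h<lo))))
    (λ h lo≤h+1 ih → begin
      k * rangeSum lo (h +1) f                      ≈⟨ *-congˡ (rangeSum-snoc f lo≤h+1) ⟩
      k * (rangeSum lo h f + f (h +1))              ≈⟨ distribˡ _ _ _ ⟩
      k * rangeSum lo h f + k * f (h +1)            ≈⟨ +-congʳ ih ⟩
      rangeSum lo h (λ i → k * f i) + k * f (h +1)  ≈⟨ rangeSum-snoc _ lo≤h+1 ⟨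
      rangeSum lo (h +1) (λ i → k * f i)            ∎)
    hi

  rangeSum-*ʳ : ∀ {lo} hi k (f : ℤ → Carrier) → rangeSum lo hi f * k ≈ rangeSum lo hi (λ i → f i * k)
  rangeSum-*ʳ hi k f =
    ≈-trans (*-comm _ _) (≈-trans (rangeSum-*ˡ hi k f) (rangeSum-cong hi (λ i → *-comm k (f i))))

  rangeSum-zero : ∀ {lo} hi (f : ℤ → Carrier) → (∀ i → lo ℤ.≤ i → i ℤ.≤ hi → f i ≈ 0#) → rangeSum lo hi f ≈ 0#
  rangeSum-zero {lo} hi f f≈0 = begin
    rangeSum lo hi f                  ≈⟨ rangeSum-cong-range hi (λ i lo≤i i≤hi → ≈-trans (f≈0 i lo≤i i≤hi) (≈-sym (zeroˡ 0#))) ⟩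
    rangeSum lo hi (λ _ → 0# * 0#)    ≈⟨ rangeSum-*ˡ hi 0# (λ _ → 0#) ⟨
    0# * rangeSum lo hi (λ _ → 0#)    ≈⟨ zeroˡ _ ⟩
    0#                                ∎

  rangeSum-extendʳ : ∀ {lo} hi hi′ f → hi ℤ.≤ hi′ → (∀ i → lo ℤ.≤ i → hi ℤ.< i → i ℤ.≤ hi′ → f i ≈ 0#) →
    rangeSum lo hi′ f ≈ rangeSum lo hi f
  rangeSum-extendʳ {lo} hi hi′ f hi≤hi′ = ≤-induction hi
    (λ h → (∀ i → lo ℤ.≤ i → hi ℤ.< i → i ℤ.≤ h → f i ≈ 0#) → rangeSum lo h f ≈ rangeSum lo hi f)
    (λ _ → ≈-refl) step hi′ hi≤hi′
    where
    step : ∀ h → hi ℤ.≤ h → ((∀ i → lo ℤ.≤ i → hi ℤ.< i → i ℤ.≤ h → f i ≈ 0#) → rangeSum lo h f ≈ rangeSum lo hi f) →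
      (∀ i → lo ℤ.≤ i → hi ℤ.< i → i ℤ.≤ h +1 → f i ≈ 0#) → rangeSum lo (h +1) f ≈ rangeSum lo hi f
    step h hi≤h ih f≈0 with ≤-or-> lo (h +1)
    ... | inj₁ lo≤h+1 = begin
      rangeSum lo (h +1) f       ≈⟨ rangeSum-snoc f lo≤h+1 ⟩
      rangeSum lo h f + f (h +1) ≈⟨ +-cong (ih (λ i lo≤i hi<i i≤h → f≈0 i lo≤i hi<i (≤⇒≤+1 i≤h)))
                                           (f≈0 (h +1) lo≤h+1 (≤⇒<+1 hi≤h) ℤP.≤-refl) ⟩
      rangeSum lo hi f + 0#      ≈⟨ +-identityʳ _ ⟩
      rangeSum lo hi f           ∎
    ... | inj₂ h+1<lo = ≈-trans (rangeSum-empty f h+1<lo)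
      (≈-sym (rangeSum-empty f (ℤP.≤-<-trans hi≤h (ℤP.<-trans (i<i+1 h) h+1<lo))))

  rangeSum-extendˡ : ∀ {lo lo′} hi f → lo′ ℤ.≤ lo → (∀ i → lo′ ℤ.≤ i → i ℤ.< lo → i ℤ.≤ hi → f i ≈ 0#) →
    rangeSum lo′ hi f ≈ rangeSum lo hi f
  rangeSum-extendˡ {lo} {lo′} hi f lo′≤lo = range-induction lo′
    (λ h → (∀ i → lo′ ℤ.≤ i → i ℤ.< lo → i ℤ.≤ h → f i ≈ 0#) → rangeSum lo′ h f ≈ rangeSum lo h f)
    (λ h h<lo′ _ → ≈-trans (rangeSum-empty f h<lo′) (≈-sym (rangeSum-empty f (ℤP.<-≤-trans h<lo′ lo′≤lo))))
    step hi
    where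
    step : ∀ h → lo′ ℤ.≤ h +1 → ((∀ i → lo′ ℤ.≤ i → i ℤ.< lo → i ℤ.≤ h → f i ≈ 0#) → rangeSum lo′ h f ≈ rangeSum lo h f) →
      (∀ i → lo′ ℤ.≤ i → i ℤ.< lo → i ℤ.≤ h +1 → f i ≈ 0#) → rangeSum lo′ (h +1) f ≈ rangeSum lo (h +1) f
    step h lo′≤h+1 ih f≈0 with ≤-or-> lo (h +1)
    ... | inj₁ lo≤h+1 = begin
      rangeSum lo′ (h +1) f       ≈⟨ rangeSum-snoc f lo′≤h+1 ⟩
      rangeSum lo′ h f + f (h +1) ≈⟨ +-congʳ (ih f≈0′) ⟩
      rangeSum lo h f + f (h +1)  ≈⟨ rangeSum-snoc f lo≤h+1 ⟨
      rangeSum lo (h +1) f        ∎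
      where
      f≈0′ : ∀ i → lo′ ℤ.≤ i → i ℤ.< lo → i ℤ.≤ h → f i ≈ 0#
      f≈0′ i lo′≤i i<lo i≤h = f≈0 i lo′≤i i<lo (≤⇒≤+1 i≤h)
    ... | inj₂ h+1<lo = begin
      rangeSum lo′ (h +1) f       ≈⟨ rangeSum-snoc f lo′≤h+1 ⟩
      rangeSum lo′ h f + f (h +1) ≈⟨ +-cong (ih f≈0′) (f≈0 (h +1) lo′≤h+1 h+1<lo ℤP.≤-refl) ⟩
      rangeSum lo h f + 0#        ≈⟨ +-identityʳ _ ⟩
      rangeSum lo h f             ≈⟨ rangeSum-empty f (ℤP.<-trans (i<i+1 h) h+1<lo) ⟩
      0#                          ≈⟨ rangeSum-empty f h+1<lo ⟨
      rangeSum lo (h +1) f        ∎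
      where
      f≈0′ : ∀ i → lo′ ℤ.≤ i → i ℤ.< lo → i ℤ.≤ h → f i ≈ 0#
      f≈0′ i lo′≤i i<lo i≤h = f≈0 i lo′≤i i<lo (≤⇒≤+1 i≤h)

  rangeSum-point : ∀ {lo} hi a f → lo ℤ.≤ a → a ℤ.≤ hi →
    (∀ i → lo ℤ.≤ i → i ℤ.≤ hi → i ≢ a → f i ≈ 0#) → rangeSum lo hi f ≈ f a
  rangeSum-point {lo} hi a f lo≤a a≤hi f≈0 = begin
    rangeSum lo hi f ≈⟨ rangeSum-extendʳ a hi f a≤hi (λ i lo≤i a<i i≤hi → f≈0 i lo≤i i≤hi (λ i≡a → ℤP.<⇒≢ a<i (P.sym i≡a))) ⟩
    rangeSum lo a f  ≈⟨ rangeSum-extendˡ a f lo≤a (λ i lo≤i i<a i≤a → f≈0 i lo≤i (ℤP.≤-trans i≤a a≤hi) (ℤP.<⇒≢ i<a)) ⟩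
    rangeSum a a f   ≈⟨ rangeSum-single a f ⟩
    f a              ∎

  rangeSum-uncons : ∀ {lo} hi f → lo ℤ.≤ hi → rangeSum lo hi f ≈ f lo + rangeSum (lo +1) hi f
  rangeSum-uncons {lo} hi f = ≤-induction lo (λ h → rangeSum lo h f ≈ f lo + rangeSum (lo +1) h f)
    (begin
      rangeSum lo lo f             ≈⟨ rangeSum-single lo f ⟩
      f lo                         ≈⟨ +-identityʳ _ ⟨
      f lo + 0#                    ≈⟨ +-congˡ (rangeSum-empty f (i<i+1 lo)) ⟨
      f lo + rangeSum (lo +1) lo f ∎)
    (λ h lo≤h ih → begin
      rangeSum lo (h +1) f                      ≈⟨ rangeSum-snoc f (≤⇒≤+1 lo≤h) ⟩
      rangeSum lo h f + f (h +1)                ≈⟨ +-congʳ ih ⟩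
      (f lo + rangeSum (lo +1) h f) + f (h +1)  ≈⟨ +-assoc _ _ _ ⟩
      f lo + (rangeSum (lo +1) h f + f (h +1))  ≈⟨ +-congˡ (rangeSum-snoc f (ℤP.+-monoˡ-≤ 1ℤ lo≤h)) ⟨
      f lo + rangeSum (lo +1) (h +1) f          ∎)
    hi

  rangeSum-shift : ∀ {lo} hi k f → rangeSum lo hi (λ i → f (k ℤ.+ i)) ≈ rangeSum (k ℤ.+ lo) (k ℤ.+ hi) f
  rangeSum-shift {lo} hi k f = range-induction lo
    (λ h → rangeSum lo h (λ i → f (k ℤ.+ i)) ≈ rangeSum (k ℤ.+ lo) (k ℤ.+ h) f)
    (λ h h<lo → ≈-trans (rangeSum-empty _ h<lo) (≈-sym (rangeSum-empty f (ℤP.+-monoʳ-< k h<lo))))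
    (λ h lo≤h+1 ih → begin
      rangeSum lo (h +1) (λ i → f (k ℤ.+ i))                 ≈⟨ rangeSum-snoc _ lo≤h+1 ⟩
      rangeSum lo h (λ i → f (k ℤ.+ i)) + f (k ℤ.+ (h +1))   ≈⟨ +-cong ih (reflexive (P.cong f (P.sym (ℤP.+-assoc k h 1ℤ)))) ⟩
      rangeSum (k ℤ.+ lo) (k ℤ.+ h) f + f (k ℤ.+ h +1)       ≈⟨ rangeSum-snoc f (P.subst (k ℤ.+ lo ℤ.≤_) (P.sym (ℤP.+-assoc k h 1ℤ)) (ℤP.+-monoʳ-≤ k lo≤h+1)) ⟨
      rangeSum (k ℤ.+ lo) (k ℤ.+ h +1) f                     ≡⟨ P.cong (λ x → rangeSum (k ℤ.+ lo) x f) (ℤP.+-assoc k h 1ℤ) ⟩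
      rangeSum (k ℤ.+ lo) (k ℤ.+ (h +1)) f                   ∎)
    hi

  rangeSum-swap : ∀ a b c d (g : ℤ → ℤ → Carrier) →
    rangeSum a b (λ i → rangeSum c d (g i)) ≈ rangeSum c d (λ j → rangeSum a b (λ i → g i j))
  rangeSum-swap a b c d g = range-induction a
    (λ b → rangeSum a b (λ i → rangeSum c d (g i)) ≈ rangeSum c d (λ j → rangeSum a b (λ i → g i j)))
    (λ h h<a → ≈-trans (rangeSum-empty _ h<a) (≈-sym (rangeSum-zero d _ (λ j _ _ → rangeSum-empty _ h<a))))
    (λ h a≤h+1 ih → begin
      rangeSum a (h +1) (λ i → rangeSum c d (g i))                              ≈⟨ rangeSum-snoc _ a≤h+1 ⟩
      rangeSum a h (λ i → rangeSum c d (g i)) + rangeSum c d (g (h +1))         ≈⟨ +-congʳ ih ⟩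
      rangeSum c d (λ j → rangeSum a h (λ i → g i j)) + rangeSum c d (g (h +1)) ≈⟨ rangeSum-+ d _ _ ⟨
      rangeSum c d (λ j → rangeSum a h (λ i → g i j) + g (h +1) j)              ≈⟨ rangeSum-cong d (λ j → rangeSum-snoc _ a≤h+1) ⟨
      rangeSum c d (λ j → rangeSum a (h +1) (λ i → g i j))                      ∎)
    b

  rangeSum-swap-triangle : ∀ c n (g : ℤ → ℤ → Carrier) →
    rangeSum c n (λ j → rangeSum j n (λ b → g b j)) ≈ rangeSum c n (λ b → rangeSum c b (g b))
  rangeSum-swap-triangle c n g = range-induction c
    (λ n → rangeSum c n (λ j → rangeSum j n (λ b → g b j)) ≈ rangeSum c n (λ b → rangeSum c b (g b)))
    (λ h h<c → ≈-trans (rangeSum-empty _ h<c) (≈-sym (rangeSum-empty _ h<c)))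
    (λ h c≤h+1 ih → begin
      rangeSum c (h +1) (λ j → rangeSum j (h +1) (λ b → g b j))
        ≈⟨ rangeSum-cong-range (h +1) (λ j _ j≤h+1 → rangeSum-snoc (λ b → g b j) j≤h+1) ⟩
      rangeSum c (h +1) (λ j → rangeSum j h (λ b → g b j) + g (h +1) j)
        ≈⟨ rangeSum-+ (h +1) _ _ ⟩
      rangeSum c (h +1) (λ j → rangeSum j h (λ b → g b j)) + rangeSum c (h +1) (g (h +1))
        ≈⟨ +-congʳ (rangeSum-snoc _ c≤h+1) ⟩
      (rangeSum c h (λ j → rangeSum j h (λ b → g b j)) + rangeSum (h +1) h (λ b → g b (h +1))) + rangeSum c (h +1) (g (h +1))
        ≈⟨ +-congʳ (+-cong ih (rangeSum-empty _ (i<i+1 h))) ⟩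
      (rangeSum c h (λ b → rangeSum c b (g b)) + 0#) + rangeSum c (h +1) (g (h +1))
        ≈⟨ +-congʳ (+-identityʳ _) ⟩
      rangeSum c h (λ b → rangeSum c b (g b)) + rangeSum c (h +1) (g (h +1))
        ≈⟨ rangeSum-snoc _ c≤h+1 ⟨
      rangeSum c (h +1) (λ b → rangeSum c b (g b)) ∎)
    n

  rangeSum-past-support : ∀ {lo} m m′ (v g : ℤ → Carrier) → (∀ j → m ℤ.< j → v j ≈ 0#) → (∀ j → m′ ℤ.< j → v j ≈ 0#) →
    rangeSum lo m (λ j → v j * g j) ≈ rangeSum lo m′ (λ j → v j * g j)
  rangeSum-past-support m m′ v g v-above-m v-above-m′ with ℤP.≤-total m m′
  ... | inj₁ m≤m′ = ≈-sym (rangeSum-extendʳ m m′ _ m≤m′ (λ j _ m<j _ → ≈-trans (*-congʳ (v-above-m j m<j)) (zeroˡ _)))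
  ... | inj₂ m′≤m = rangeSum-extendʳ m′ m _ m′≤m (λ j _ m′<j _ → ≈-trans (*-congʳ (v-above-m′ j m′<j)) (zeroˡ _))

  -- Lower-triangular matrices indexed by ℤ

  δ : ℤ → ℤ → Carrier
  δ i j = if does (i ℤP.≟ j) then 1# else 0#

  δ-refl : ∀ i → δ i i ≈ 1#
  δ-refl i rewrite dec-true (i ℤP.≟ i) P.refl = ≈-refl

  δ-≢ : ∀ {i j} → i ≢ j → δ i j ≈ 0#
  δ-≢ {i} {j} i≢j rewrite dec-false (i ℤP.≟ j) i≢j = ≈-refl

  Matrix : Set c
  Matrix = ℤ → ℤ → Carrier

  -- Active z c says whether column c matters in I^α when z = isZeroB α: for α = (0)
  -- only columns c ≥ 0 do, as λ_c^(0) = 0 for c < 0.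
  Active : Bool → ℤ → Set
  Active true  c = 0ℤ ℤ.≤ c
  Active false c = ⊤

  active-mono : ∀ z {c j} → Active z c → c ℤ.≤ j → Active z j
  active-mono true  0≤c c≤j = ℤP.≤-trans 0≤c c≤j
  active-mono false _   _   = tt

  active? : ∀ z c → Dec (Active z c)
  active? true  c = 0ℤ ℤP.≤? c
  active? false c = yes tt

  active-0 : ∀ z → Active z 0ℤ
  active-0 true  = ℤP.≤-refl
  active-0 false = tt

  infix 4 _≈M[_]_
  _≈M[_]_ : Matrix → Bool → Matrix → Set ℓ
  A ≈M[ z ] B = ∀ b c → Active z c → c ℤ.≤ b → A b c ≈ B b c

  matrixSetoid : Bool → Setoid c ℓ
  matrixSetoid z = record
    { Carrier = Matrix
    ; _≈_ = λ A B → A ≈M[ z ] B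
    ; isEquivalence = record
      { refl  = λ b c _ _ → ≈-refl
      ; sym   = λ A≈B b c z c≤b → ≈-sym (A≈B b c z c≤b)
      ; trans = λ A≈B B≈C b c z c≤b → ≈-trans (A≈B b c z c≤b) (B≈C b c z c≤b)
      }
    }

  module ≈M {z : Bool} = Setoid (matrixSetoid z)

  1M : Matrix
  1M b c = δ c b

  infixl 7 _·_
  _·_ : Matrix → Matrix → Matrix
  (A · B) b c = rangeSum c b (λ j → A b j * B j c)

  ·-cong : ∀ {z A A′ B B′} → A ≈M[ z ] A′ → B ≈M[ z ] B′ → A · B ≈M[ z ] A′ · B′
  ·-cong {z} A≈A′ B≈B′ b c zc c≤b =
    rangeSum-cong-range b (λ j c≤j j≤b → *-cong (A≈A′ b j (active-mono z zc c≤j) j≤b) (B≈B′ j c zc c≤j))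

  ·-assoc-entry : ∀ A B C b c → ((A · B) · C) b c ≈ (A · (B · C)) b c
  ·-assoc-entry A B C b c = begin
    rangeSum c b (λ j → rangeSum j b (λ k → A b k * B k j) * C j c)
      ≈⟨ rangeSum-cong b (λ j → rangeSum-*ʳ b (C j c) (λ k → A b k * B k j)) ⟩
    rangeSum c b (λ j → rangeSum j b (λ k → (A b k * B k j) * C j c))
      ≈⟨ rangeSum-swap-triangle c b (λ k j → (A b k * B k j) * C j c) ⟩
    rangeSum c b (λ k → rangeSum c k (λ j → (A b k * B k j) * C j c))
      ≈⟨ rangeSum-cong b (λ k → ≈-trans (rangeSum-cong k (λ j → *-assoc _ _ _))
                                          (≈-sym (rangeSum-*ˡ k (A b k) (λ j → B k j * C j c)))) ⟩
    rangeSum c b (λ k → A b k * rangeSum c k (λ j → B k j * C j c))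
      ∎

  ·-assoc : ∀ {z} A B C → (A · B) · C ≈M[ z ] A · (B · C)
  ·-assoc A B C b c _ _ = ·-assoc-entry A B C b c

  ·-identityˡ-entry : ∀ A b c → c ℤ.≤ b → (1M · A) b c ≈ A b c
  ·-identityˡ-entry A b c c≤b = begin
    rangeSum c b (λ j → 1M b j * A j c) ≈⟨ rangeSum-point b b _ c≤b ℤP.≤-refl
                                             (λ j _ _ j≢b → ≈-trans (*-congʳ (δ-≢ j≢b)) (zeroˡ _)) ⟩
    1M b b * A b c                      ≈⟨ ≈-trans (*-congʳ (δ-refl b)) (*-identityˡ _) ⟩
    A b c                               ∎

  ·-identityʳ-entry : ∀ A b c → c ℤ.≤ b → (A · 1M) b c ≈ A b c
  ·-identityʳ-entry A b c c≤b = begin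
    rangeSum c b (λ j → A b j * 1M j c) ≈⟨ rangeSum-point b c _ ℤP.≤-refl c≤b
                                             (λ j _ _ j≢c → ≈-trans (*-congˡ (δ-≢ (λ c≡j → j≢c (P.sym c≡j)))) (zeroʳ _)) ⟩
    A b c * 1M c c                      ≈⟨ ≈-trans (*-congˡ (δ-refl c)) (*-identityʳ _) ⟩
    A b c                               ∎

  ·-identityˡ : ∀ {z} A → 1M · A ≈M[ z ] A
  ·-identityˡ A b c _ = ·-identityˡ-entry A b c

  ·-identityʳ : ∀ {z} A → A · 1M ≈M[ z ] A
  ·-identityʳ A b c _ = ·-identityʳ-entry A b c

  rangeSum-− : ∀ {lo} hi (f g : ℤ → Carrier) →
    rangeSum lo hi (λ i → f i - g i) ≈ rangeSum lo hi f - rangeSum lo hi g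
  rangeSum-− {lo} hi f g = begin
    rangeSum lo hi (λ i → f i - g i)                        ≈⟨ rangeSum-+ hi f (λ i → - g i) ⟩
    rangeSum lo hi f + rangeSum lo hi (λ i → - g i)         ≈⟨ +-congˡ (rangeSum-cong hi (λ i → -1*x≈-x (g i))) ⟨
    rangeSum lo hi f + rangeSum lo hi (λ i → - 1# * g i)    ≈⟨ +-congˡ (rangeSum-*ˡ hi (- 1#) g) ⟨
    rangeSum lo hi f + - 1# * rangeSum lo hi g              ≈⟨ +-congˡ (-1*x≈-x _) ⟩
    rangeSum lo hi f - rangeSum lo hi g                     ∎

  ·-cancelʳ : ∀ z (P X Y : Matrix) → (∀ c → Active z c → P c c ≉ 0#) → X · P ≈M[ z ] Y · P → X ≈M[ z ] Y
  ·-cancelʳ z P X Y P-diag XP≈YP b c zc c≤b =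
    x∙y⁻¹≈ε⇒x≈y _ _ (≥-induction (b +1) Q (λ i b+1≤i i≤b _ → ⊥-elim (ℤP.<-irrefl P.refl (ℤP.<-≤-trans (≤⇒<+1 i≤b) b+1≤i)))
                                 step c (≤⇒≤+1 c≤b) c ℤP.≤-refl c≤b zc)
    where
    D : ℤ → Carrier
    D j = X b j - Y b j
    Q : ℤ → Set ℓ
    Q j = ∀ i → j ℤ.≤ i → i ℤ.≤ b → Active z i → D i ≈ 0#
    row : ∀ j → Active z j → j ℤ.≤ b → rangeSum j b (λ i → D i * P i j) ≈ 0#
    row j zj j≤b = begin
      rangeSum j b (λ i → D i * P i j)                   ≈⟨ rangeSum-cong b (λ i → [y-z]x≈yx-zx _ _ _) ⟩
      rangeSum j b (λ i → X b i * P i j - Y b i * P i j) ≈⟨ rangeSum-− b _ _ ⟩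
      (X · P) b j - (Y · P) b j                          ≈⟨ +-congʳ (XP≈YP b j zj j≤b) ⟩
      (Y · P) b j - (Y · P) b j                          ≈⟨ -‿inverseʳ _ ⟩
      0#                                                 ∎
    diagonal : ∀ i → Active z i → i ℤ.≤ b → (∀ k → i +1 ℤ.≤ k → k ℤ.≤ b → D k ≈ 0#) → D i ≈ 0#
    diagonal i zi i≤b above≈0 = nonzero-cancelʳ (P-diag i zi) (begin
      D i * P i i                                     ≈⟨ +-identityʳ _ ⟨
      D i * P i i + 0#                                ≈⟨ +-congˡ (rangeSum-zero b _ (λ k i+1≤k k≤b → ≈-trans (*-congʳ (above≈0 k i+1≤k k≤b)) (zeroˡ _))) ⟨
      D i * P i i + rangeSum (i +1) b (λ k → D k * P k i) ≈⟨ rangeSum-uncons b _ i≤b ⟨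
      rangeSum i b (λ k → D k * P k i)                ≈⟨ row i zi i≤b ⟩
      0#                                              ∎)
    step : ∀ j → j ℤ.< b +1 → Q (j +1) → Q j
    step j _ ih i j≤i i≤b zi with ≤-or-> (j +1) i
    ... | inj₁ j+1≤i = ih i j+1≤i i≤b zi
    ... | inj₂ i<j+1 = diagonal i zi i≤b (λ k i+1≤k k≤b →
      ih k (ℤP.≤-trans (ℤP.+-monoˡ-≤ 1ℤ j≤i) i+1≤k) k≤b (active-mono z zi (ℤP.≤-trans (ℤP.<⇒≤ (i<i+1 i)) i+1≤k)))

  module LeftInverse (z : Bool) (P : Matrix) (P-diag : ∀ c → Active z c → P c c ≉ 0#) where

    diagInv : ℤ → Carrier
    diagInv c with active? z c
    ... | yes zc = inv (P c c) (P-diag c zc)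
    ... | no _   = 0#

    diagInv-* : ∀ c → Active z c → diagInv c * P c c ≈ 1#
    diagInv-* c zc with active? z c
    ... | yes _  = ≈-trans (*-comm _ _) (inv-cancel _ _)
    ... | no ¬zc = ⊥-elim (¬zc zc)

    -- Entry (b, c) is determined by the entries (b, j), c < j ≤ b; the fuel bounds b − c.
    approx : ℕ → Matrix
    approx zero    b c = 0#
    approx (suc n) b c = (1M b c - rangeSum (c +1) b (λ j → approx n b j * P j c)) * diagInv c

    leftInverse : Matrix
    leftInverse b c = approx (suc ℤ.∣ b ℤ.- c ∣) b c

    private
      shrink : ∀ {b c j} k → c +1 ℤ.≤ j → b ℤ.- c ℤ.< + suc k → b ℤ.- j ℤ.< + k
      shrink {b} {c} k c+1≤j b−c<1+k = ℤP.≤-<-trans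
        (ℤP.≤-trans (ℤP.+-monoʳ-≤ b (ℤP.neg-mono-≤ c+1≤j)) (ℤP.≤-reflexive (i−[j+1]≡-1+[i−j] b c)))
        (ℤP.+-monoʳ-< -1ℤ b−c<1+k)

    approx-irrelevant : ∀ m n {b c} → c ℤ.≤ b → b ℤ.- c ℤ.< + m → b ℤ.- c ℤ.< + n → approx m b c ≈ approx n b c
    approx-irrelevant zero    _       c≤b b−c<0 _     = ⊥-elim (ℤP.<⇒≱ b−c<0 (ℤP.i≤j⇒0≤j-i c≤b))
    approx-irrelevant (suc m) zero    c≤b _     b−c<0 = ⊥-elim (ℤP.<⇒≱ b−c<0 (ℤP.i≤j⇒0≤j-i c≤b))
    approx-irrelevant (suc m) (suc n) {b} {c} c≤b b−c<1+m b−c<1+n =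
      *-congʳ (+-congˡ (-‿cong (rangeSum-cong-range b (λ j c+1≤j j≤b →
        *-congʳ (approx-irrelevant m n j≤b (shrink {b} {c} m c+1≤j b−c<1+m) (shrink {b} {c} n c+1≤j b−c<1+n))))))

    ∣b−c∣-bound : ∀ {b c} → c ℤ.≤ b → b ℤ.- c ℤ.< + suc ℤ.∣ b ℤ.- c ∣
    ∣b−c∣-bound c≤b = ℤP.≤-<-trans (ℤP.≤-reflexive (P.sym (ℤP.0≤i⇒+∣i∣≡i (ℤP.i≤j⇒0≤j-i c≤b)))) (ℤ.+<+ (ℕP.n<1+n _))

    leftInverse-unfold : ∀ b c → c ℤ.≤ b →
      leftInverse b c ≈ (1M b c - rangeSum (c +1) b (λ j → leftInverse b j * P j c)) * diagInv c
    leftInverse-unfold b c c≤b = *-congʳ (+-congˡ (-‿cong (rangeSum-cong-range b (λ j c+1≤j j≤b →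
      *-congʳ (approx-irrelevant ℤ.∣ b ℤ.- c ∣ (suc ℤ.∣ b ℤ.- j ∣) j≤b (shrink {b} {c} ℤ.∣ b ℤ.- c ∣ c+1≤j (∣b−c∣-bound {b} {c} c≤b)) (∣b−c∣-bound {b} {j} j≤b))))))

    leftInverse-· : leftInverse · P ≈M[ z ] 1M
    leftInverse-· b c zc c≤b = begin
      rangeSum c b (λ j → leftInverse b j * P j c) ≈⟨ rangeSum-uncons b _ c≤b ⟩
      leftInverse b c * P c c + S                  ≈⟨ +-congʳ (*-congʳ (leftInverse-unfold b c c≤b)) ⟩
      ((1M b c - S) * diagInv c) * P c c + S       ≈⟨ +-congʳ (*-assoc _ _ _) ⟩
      (1M b c - S) * (diagInv c * P c c) + S       ≈⟨ +-congʳ (*-congˡ (diagInv-* c zc)) ⟩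
      (1M b c - S) * 1# + S                        ≈⟨ +-congʳ (*-identityʳ _) ⟩
      (1M b c - S) + S                             ≈⟨ //-rightDividesˡ S (1M b c) ⟩
      1M b c                                       ∎
      where
      S : Carrier
      S = rangeSum (c +1) b (λ j → leftInverse b j * P j c)

  infixl 8 _^M_
  _^M_ : Matrix → ℕ → Matrix
  X ^M zero  = 1M
  X ^M suc k = X ^M k · X

  StrictlyLower : Bool → Matrix → Set ℓ
  StrictlyLower z X = ∀ b c → Active z c → b ℤ.≤ c → X b c ≈ 0#

  ^M-vanish : ∀ {z X} → StrictlyLower z X → ∀ k b c → Active z c → b ℤ.< c ℤ.+ + k → (X ^M k) b c ≈ 0#
  ^M-vanish X-lower zero b c _ b<c+0 = δ-≢ (λ c≡b → ℤP.<-irrefl (P.sym c≡b) (P.subst (b ℤ.<_) (ℤP.+-identityʳ c) b<c+0))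
  ^M-vanish {z} {X} X-lower (suc k) b c zc b<c+1+k = rangeSum-zero b _ (λ j c≤j _ → term j c≤j (≤-or-> j c))
    where
    term : ∀ j → c ℤ.≤ j → j ℤ.≤ c ⊎ c ℤ.< j → (X ^M k) b j * X j c ≈ 0#
    term j _   (inj₁ j≤c) = ≈-trans (*-congˡ (X-lower j c zc j≤c)) (zeroʳ _)
    term j c≤j (inj₂ c<j) = ≈-trans (*-congʳ (^M-vanish X-lower k b j (active-mono z zc c≤j) b<j+k)) (zeroˡ _)
      where
      b<j+k : b ℤ.< j ℤ.+ + k
      b<j+k = ℤP.<-≤-trans b<c+1+k
        (P.subst (ℤ._≤ j ℤ.+ + k) (ℤP.+-assoc c 1ℤ (+ k)) (ℤP.+-monoˡ-≤ (+ k) (<⇒+1≤ c<j)))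

  ^M-intertwine : ∀ {z} T G H → T · G ≈M[ z ] H · T → ∀ k → T · G ^M k ≈M[ z ] H ^M k · T
  ^M-intertwine T G H TG≈HT zero = ≈M.trans (·-identityʳ T) (≈M.sym (·-identityˡ T))
  ^M-intertwine T G H TG≈HT (suc k) b c zc c≤b = begin
    (T · (G ^M k · G)) b c  ≈⟨ ·-assoc T (G ^M k) G b c zc c≤b ⟨
    (T · G ^M k · G) b c    ≈⟨ ·-cong (^M-intertwine T G H TG≈HT k) (≈M.refl {x = G}) b c zc c≤b ⟩
    (H ^M k · T · G) b c    ≈⟨ ·-assoc (H ^M k) T G b c zc c≤b ⟩
    (H ^M k · (T · G)) b c  ≈⟨ ·-cong (≈M.refl {x = H ^M k}) TG≈HT b c zc c≤b ⟩
    (H ^M k · (H · T)) b c  ≈⟨ ·-assoc (H ^M k) H T b c zc c≤b ⟨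
    (H ^M k · H · T) b c    ∎

  -- Σ_k φ k · X^k, truncated at k = b − c: beyond it X^k vanishes at (b, c) when X is strictly lower.
  powerSeries : (ℤ → Carrier) → Matrix → Matrix
  powerSeries φ X b c = rangeSum 0ℤ (b ℤ.- c) (λ k → φ k * (X ^M ℤ.∣ k ∣) b c)

  private
    untruncate : ∀ {z X} → StrictlyLower z X → ∀ (φ : ℤ → Carrier) b c m → Active z c → b ℤ.- c ℤ.≤ m →
      rangeSum 0ℤ m (λ k → φ k * (X ^M ℤ.∣ k ∣) b c) ≈ rangeSum 0ℤ (b ℤ.- c) (λ k → φ k * (X ^M ℤ.∣ k ∣) b c)
    untruncate X-lower φ b c m zc b−c≤m = rangeSum-extendʳ (b ℤ.- c) m _ b−c≤m (λ k 0≤k b−c<k _ →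
      ≈-trans (*-congˡ (^M-vanish X-lower ℤ.∣ k ∣ b c zc
                 (ℤP.≤-<-trans (ℤP.≤-reflexive (P.sym (i+[j−i]≡j c b))) (ℤP.+-monoʳ-< c (P.subst (b ℤ.- c ℤ.<_) (P.sym (ℤP.0≤i⇒+∣i∣≡i 0≤k)) b−c<k)))))
              (zeroʳ _))

  powerSeries-·ʳ : ∀ {z X} → StrictlyLower z X → ∀ (φ : ℤ → Carrier) Y → powerSeries φ X · Y ≈M[ z ] λ b c →
    rangeSum 0ℤ (b ℤ.- c) (λ k → φ k * (X ^M ℤ.∣ k ∣ · Y) b c)
  powerSeries-·ʳ {z} {X} X-lower φ Y b c zc c≤b = begin
    rangeSum c b (λ j → rangeSum 0ℤ (b ℤ.- j) (λ k → φ k * (X ^M ℤ.∣ k ∣) b j) * Y j c)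
      ≈⟨ rangeSum-cong-range b (λ j c≤j _ → *-congʳ (≈-sym (untruncate X-lower φ b j (b ℤ.- c) (active-mono z zc c≤j)
                                                                 (ℤP.+-monoʳ-≤ b (ℤP.neg-mono-≤ c≤j))))) ⟩
    rangeSum c b (λ j → rangeSum 0ℤ (b ℤ.- c) (λ k → φ k * (X ^M ℤ.∣ k ∣) b j) * Y j c)
      ≈⟨ rangeSum-cong b (λ j → ≈-trans (rangeSum-*ʳ (b ℤ.- c) (Y j c) _) (rangeSum-cong (b ℤ.- c) (λ k → *-assoc _ _ _))) ⟩
    rangeSum c b (λ j → rangeSum 0ℤ (b ℤ.- c) (λ k → φ k * ((X ^M ℤ.∣ k ∣) b j * Y j c)))
      ≈⟨ rangeSum-swap c b 0ℤ (b ℤ.- c) _ ⟩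
    rangeSum 0ℤ (b ℤ.- c) (λ k → rangeSum c b (λ j → φ k * ((X ^M ℤ.∣ k ∣) b j * Y j c)))
      ≈⟨ rangeSum-cong (b ℤ.- c) (λ k → rangeSum-*ˡ b (φ k) _) ⟨
    rangeSum 0ℤ (b ℤ.- c) (λ k → φ k * (X ^M ℤ.∣ k ∣ · Y) b c)
      ∎

  powerSeries-·ˡ : ∀ {z X} → StrictlyLower z X → ∀ (φ : ℤ → Carrier) Y → Y · powerSeries φ X ≈M[ z ] λ b c →
    rangeSum 0ℤ (b ℤ.- c) (λ k → φ k * (Y · X ^M ℤ.∣ k ∣) b c)
  powerSeries-·ˡ {z} {X} X-lower φ Y b c zc c≤b = begin
    rangeSum c b (λ j → Y b j * rangeSum 0ℤ (j ℤ.- c) (λ k → φ k * (X ^M ℤ.∣ k ∣) j c))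
      ≈⟨ rangeSum-cong-range b (λ j _ j≤b → *-congˡ (≈-sym (untruncate X-lower φ j c (b ℤ.- c) zc
                                                                (ℤP.+-monoˡ-≤ (ℤ.- c) j≤b)))) ⟩
    rangeSum c b (λ j → Y b j * rangeSum 0ℤ (b ℤ.- c) (λ k → φ k * (X ^M ℤ.∣ k ∣) j c))
      ≈⟨ rangeSum-cong b (λ j → ≈-trans (rangeSum-*ˡ (b ℤ.- c) (Y b j) _) (rangeSum-cong (b ℤ.- c) (λ k → x∙yz≈y∙xz _ _ _))) ⟩
    rangeSum c b (λ j → rangeSum 0ℤ (b ℤ.- c) (λ k → φ k * (Y b j * (X ^M ℤ.∣ k ∣) j c)))
      ≈⟨ rangeSum-swap c b 0ℤ (b ℤ.- c) _ ⟩
    rangeSum 0ℤ (b ℤ.- c) (λ k → rangeSum c b (λ j → φ k * (Y b j * (X ^M ℤ.∣ k ∣) j c)))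
      ≈⟨ rangeSum-cong (b ℤ.- c) (λ k → rangeSum-*ˡ b (φ k) _) ⟨
    rangeSum 0ℤ (b ℤ.- c) (λ k → φ k * (Y · X ^M ℤ.∣ k ∣) b c)
      ∎

  powerSeries-intertwine : ∀ {z} T G H → StrictlyLower z G → StrictlyLower z H → T · G ≈M[ z ] H · T →
    ∀ φ → T · powerSeries φ G ≈M[ z ] powerSeries φ H · T
  powerSeries-intertwine T G H G-lower H-lower TG≈HT φ b c zc c≤b = begin
    (T · powerSeries φ G) b c
      ≈⟨ powerSeries-·ˡ G-lower φ T b c zc c≤b ⟩
    rangeSum 0ℤ (b ℤ.- c) (λ k → φ k * (T · G ^M ℤ.∣ k ∣) b c)
      ≈⟨ rangeSum-cong (b ℤ.- c) (λ k → *-congˡ (^M-intertwine T G H TG≈HT ℤ.∣ k ∣ b c zc c≤b)) ⟩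
    rangeSum 0ℤ (b ℤ.- c) (λ k → φ k * (H ^M ℤ.∣ k ∣ · T) b c)
      ≈⟨ powerSeries-·ʳ H-lower φ T b c zc c≤b ⟨
    (powerSeries φ H · T) b c
      ∎

  -- Formal series in D and their matrices

  Series : Set c
  Series = ℤ → Carrier

  -- φ(D) λ_b = Σ_c φ (b − c) (⌊b⌉! / ⌊c⌉!) λ_c
  matrixOf : Series → Matrix
  matrixOf φ b c = φ (b ℤ.- c) * ratio b (b ℤ.- c)

  infixl 7 _⊛_
  _⊛_ : Series → Series → Series
  (φ ⊛ ψ) n = rangeSum 0ℤ n (λ i → φ (n ℤ.- i) * ψ i)

  δ₀ δ₁ : Series
  δ₀ n = δ n 0ℤ
  δ₁ n = δ n 1ℤ

  infixr 8 _^S_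
  _^S_ : Series → ℕ → Series
  φ ^S zero  = δ₀
  φ ^S suc k = φ ^S k ⊛ φ

  infixr 9 _∘S_
  _∘S_ : Series → Series → Series
  (ψ ∘S φ) n = rangeSum 0ℤ n (λ k → ψ k * (φ ^S ℤ.∣ k ∣) n)

  Dmatrix : Matrix
  Dmatrix = matrixOf δ₁

  Order≥1 : Series → Set ℓ
  Order≥1 φ = ∀ n → n ℤ.< 1ℤ → φ n ≈ 0#

  matrixOf-⊛ : ∀ φ ψ b c → (matrixOf φ · matrixOf ψ) b c ≈ matrixOf (φ ⊛ ψ) b c
  matrixOf-⊛ φ ψ b c = begin
    rangeSum c b (λ j → (φ (b ℤ.- j) * ratio b (b ℤ.- j)) * (ψ (j ℤ.- c) * ratio j (j ℤ.- c)))
      ≈⟨ rangeSum-cong b (λ j → ≈-trans (*-interchange _ _ _ _) (*-congˡ (telescope j))) ⟩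
    rangeSum c b (λ j → (φ (b ℤ.- j) * ψ (j ℤ.- c)) * (fact b * invFact c))
      ≈⟨ rangeSum-*ʳ b _ _ ⟨
    rangeSum c b g * (fact b * invFact c)
      ≈⟨ *-cong shifted (*-congˡ (reflexive (P.cong invFact (P.sym (i−[i−j]≡j b c))))) ⟩
    rangeSum 0ℤ (b ℤ.- c) (λ i → φ ((b ℤ.- c) ℤ.- i) * ψ i) * ratio b (b ℤ.- c)
      ∎
    where
    telescope : ∀ j → ratio b (b ℤ.- j) * ratio j (j ℤ.- c) ≈ fact b * invFact c
    telescope j rewrite i−[i−j]≡j b j | i−[i−j]≡j j c = factRatio-telescope b j c
    g : ℤ → Carrier
    g j = φ (b ℤ.- j) * ψ (j ℤ.- c)
    shifted : rangeSum c b g ≈ rangeSum 0ℤ (b ℤ.- c) (λ i → φ ((b ℤ.- c) ℤ.- i) * ψ i)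
    shifted = begin
      rangeSum c b g                         ≡⟨ P.cong₂ (λ lo hi → rangeSum lo hi g) (ℤP.+-identityʳ c) (i+[j−i]≡j c b) ⟨
      rangeSum (c ℤ.+ 0ℤ) (c ℤ.+ (b ℤ.- c)) g ≈⟨ rangeSum-shift (b ℤ.- c) c g ⟨
      rangeSum 0ℤ (b ℤ.- c) (λ i → g (c ℤ.+ i)) ≈⟨ rangeSum-cong (b ℤ.- c) (λ i → reflexive
                                                     (P.cong₂ (λ m n → φ m * ψ n) (i−[j+k]≡[i−j]−k b c i) ([i+j]−i≡j c i))) ⟩
      rangeSum 0ℤ (b ℤ.- c) (λ i → φ ((b ℤ.- c) ℤ.- i) * ψ i) ∎

  matrixOf-δ₀ : ∀ {z} → matrixOf δ₀ ≈M[ z ] 1M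
  matrixOf-δ₀ b c _ c≤b with b ℤP.≟ c
  ... | yes P.refl = begin
    δ (b ℤ.- b) 0ℤ * ratio b (b ℤ.- b) ≡⟨ P.cong (λ n → δ n 0ℤ * ratio b n) (ℤP.+-inverseʳ b) ⟩
    δ 0ℤ 0ℤ * ratio b 0ℤ               ≈⟨ *-cong (δ-refl 0ℤ) (ratio-zero b) ⟩
    1# * 1#                            ≈⟨ *-identityˡ 1# ⟩
    1#                                 ≈⟨ δ-refl b ⟨
    1M b b                             ∎
  ... | no b≢c = ≈-trans (*-congʳ (δ-≢ (λ b−c≡0 → b≢c (ℤP.i-j≡0⇒i≡j b c b−c≡0))))
                         (≈-trans (zeroˡ _) (≈-sym (δ-≢ (λ c≡b → b≢c (P.sym c≡b)))))

  matrixOf-cong : ∀ {z} φ ψ → (∀ n → 0ℤ ℤ.≤ n → φ n ≈ ψ n) → matrixOf φ ≈M[ z ] matrixOf ψ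
  matrixOf-cong φ ψ φ≈ψ b c _ c≤b = *-congʳ (φ≈ψ (b ℤ.- c) (ℤP.i≤j⇒0≤j-i c≤b))

  matrixOf-^S : ∀ {z} φ k → matrixOf (φ ^S k) ≈M[ z ] matrixOf φ ^M k
  matrixOf-^S φ zero = matrixOf-δ₀
  matrixOf-^S φ (suc k) b c zc c≤b =
    ≈-trans (≈-sym (matrixOf-⊛ (φ ^S k) φ b c)) (·-cong (matrixOf-^S φ k) (≈M.refl {x = matrixOf φ}) b c zc c≤b)

  matrixOf-∘S : ∀ {z} ψ φ → matrixOf (ψ ∘S φ) ≈M[ z ] powerSeries ψ (matrixOf φ)
  matrixOf-∘S ψ φ b c zc c≤b = begin
    rangeSum 0ℤ (b ℤ.- c) (λ k → ψ k * (φ ^S ℤ.∣ k ∣) (b ℤ.- c)) * ratio b (b ℤ.- c)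
      ≈⟨ rangeSum-*ʳ (b ℤ.- c) _ _ ⟩
    rangeSum 0ℤ (b ℤ.- c) (λ k → (ψ k * (φ ^S ℤ.∣ k ∣) (b ℤ.- c)) * ratio b (b ℤ.- c))
      ≈⟨ rangeSum-cong (b ℤ.- c) (λ k → ≈-trans (*-assoc _ _ _) (*-congˡ (matrixOf-^S φ ℤ.∣ k ∣ b c zc c≤b))) ⟩
    rangeSum 0ℤ (b ℤ.- c) (λ k → ψ k * (matrixOf φ ^M ℤ.∣ k ∣) b c)
      ∎

  matrixOf-strictlyLower : ∀ {z} φ → Order≥1 φ → StrictlyLower z (matrixOf φ)
  matrixOf-strictlyLower φ φ-order b c _ b≤c =
    ≈-trans (*-congʳ (φ-order (b ℤ.- c) (ℤP.≤-<-trans (ℤP.i≤j⇒i-j≤0 b≤c) 0<1))) (zeroˡ _)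

  δ₁-order≥1 : Order≥1 δ₁
  δ₁-order≥1 n n<1 = δ-≢ (λ n≡1 → ℤP.<-irrefl n≡1 n<1)

  Dmatrix-· : ∀ X b c → c ℤ.≤ b → (b −1 ℤ.< c → X (b −1) c ≈ 0#) → (Dmatrix · X) b c ≈ fromℤ ⌊ b ⌉ * X (b −1) c
  Dmatrix-· X b c c≤b X-upper with ≤-or-> c (b −1)
  ... | inj₁ c≤b−1 = begin
    rangeSum c b (λ j → Dmatrix b j * X j c)
      ≈⟨ rangeSum-point b (b −1) _ c≤b−1 (ℤP.<⇒≤ (i−1<i b))
           (λ j _ _ j≢b−1 → ≈-trans (*-congʳ (≈-trans (*-congʳ (δ-≢ (λ b−j≡1 → j≢b−1 (i−j≡1⇒j≡i−1 b _ b−j≡1)))) (zeroˡ _))) (zeroˡ _)) ⟩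
    (δ₁ (b ℤ.- (b −1)) * ratio b (b ℤ.- (b −1))) * X (b −1) c
      ≡⟨ P.cong (λ n → (δ₁ n * ratio b n) * X (b −1) c) (i−[i−j]≡j b 1ℤ) ⟩
    (δ₁ 1ℤ * ratio b 1ℤ) * X (b −1) c
      ≈⟨ *-congʳ (≈-trans (*-cong (δ-refl 1ℤ) (ratio-one b)) (*-identityˡ _)) ⟩
    fromℤ ⌊ b ⌉ * X (b −1) c
      ∎
  ... | inj₂ b−1<c = begin
    rangeSum c b (λ j → Dmatrix b j * X j c)
      ≈⟨ rangeSum-zero b _ (λ j c≤j _ → ≈-trans (*-congʳ (≈-trans (*-congʳ (δ-≢ (λ b−j≡1 →
           ℤP.<-irrefl P.refl (ℤP.<-≤-trans b−1<c (ℤP.≤-trans c≤j (ℤP.≤-reflexive (i−j≡1⇒j≡i−1 b _ b−j≡1))))))) (zeroˡ _))) (zeroˡ _)) ⟩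
    0#                        ≈⟨ zeroʳ _ ⟨
    fromℤ ⌊ b ⌉ * 0#          ≈⟨ *-congˡ (X-upper b−1<c) ⟨
    fromℤ ⌊ b ⌉ * X (b −1) c  ∎

  ^-nonzero : ∀ {x} k → x ≉ 0# → x ^ k ≉ 0#
  ^-nonzero zero    x≉0 = 1≉0
  ^-nonzero (suc k) x≉0 = *-nonzero x≉0 (^-nonzero k x≉0)

  ^S-vanish : ∀ φ → Order≥1 φ → ∀ k n → n ℤ.< + k → (φ ^S k) n ≈ 0#
  ^S-vanish φ φ-order zero    n n<0 = δ-≢ (λ n≡0 → ℤP.<-irrefl n≡0 n<0)
  ^S-vanish φ φ-order (suc k) n n<1+k = rangeSum-zero n _ (λ i _ _ → term i (≤-or-> 1ℤ i))
    where
    term : ∀ i → 1ℤ ℤ.≤ i ⊎ i ℤ.< 1ℤ → (φ ^S k) (n ℤ.- i) * φ i ≈ 0#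
    term i (inj₁ 1≤i) = ≈-trans (*-congʳ (^S-vanish φ φ-order k (n ℤ.- i)
                                   (ℤP.+-mono-<-≤ n<1+k (ℤP.neg-mono-≤ 1≤i)))) (zeroˡ _)
    term i (inj₂ i<1) = ≈-trans (*-congˡ (φ-order i i<1)) (zeroʳ _)

  ^S-leading : ∀ φ → Order≥1 φ → ∀ k → (φ ^S k) (+ k) ≈ φ 1ℤ ^ k
  ^S-leading φ φ-order zero    = δ-refl 0ℤ
  ^S-leading φ φ-order (suc k) = begin
    rangeSum 0ℤ (+ suc k) (λ i → (φ ^S k) (+ suc k ℤ.- i) * φ i)
      ≈⟨ rangeSum-point (+ suc k) 1ℤ _ (ℤP.<⇒≤ 0<1) (ℤ.+≤+ (ℕ.s≤s ℕ.z≤n)) (λ i _ _ i≢1 → term i i≢1 (≤-or-> 1ℤ i)) ⟩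
    (φ ^S k) (+ k) * φ 1ℤ   ≈⟨ *-congʳ (^S-leading φ φ-order k) ⟩
    φ 1ℤ ^ k * φ 1ℤ         ≈⟨ *-comm _ _ ⟩
    φ 1ℤ ^ suc k            ∎
    where
    term : ∀ i → i ≢ 1ℤ → 1ℤ ℤ.≤ i ⊎ i ℤ.< 1ℤ → (φ ^S k) (+ suc k ℤ.- i) * φ i ≈ 0#
    term i i≢1 (inj₁ 1≤i) = ≈-trans (*-congʳ (^S-vanish φ φ-order k _
      (ℤP.+-monoʳ-< (+ suc k) (ℤP.neg-mono-< (ℤP.≤∧≢⇒< 1≤i (λ 1≡i → i≢1 (P.sym 1≡i))))))) (zeroˡ _)
    term i _   (inj₂ i<1) = ≈-trans (*-congˡ (φ-order i i<1)) (zeroʳ _)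

  δ-resp : ∀ {i j i′ j′} → (i ≡ j → i′ ≡ j′) → (i′ ≡ j′ → i ≡ j) → δ i j ≈ δ i′ j′
  δ-resp {i} {j} {i′} {j′} to from with i ℤP.≟ j | i′ ℤP.≟ j′
  ... | yes _   | yes _    = ≈-refl
  ... | no _    | no _     = ≈-refl
  ... | yes i≡j | no i′≢j′ = ⊥-elim (i′≢j′ (to i≡j))
  ... | no i≢j  | yes i′≡j′ = ⊥-elim (i≢j (from i′≡j′))

  δ₁-^S : ∀ k n → (δ₁ ^S k) n ≈ δ n (+ k)
  δ₁-^S zero    n = ≈-refl
  δ₁-^S (suc k) n with ≤-or-> 1ℤ n
  ... | inj₁ 1≤n = begin
    rangeSum 0ℤ n (λ i → (δ₁ ^S k) (n ℤ.- i) * δ₁ i)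
      ≈⟨ rangeSum-point n 1ℤ _ (ℤP.<⇒≤ 0<1) 1≤n (λ i _ _ i≢1 → ≈-trans (*-congˡ (δ-≢ i≢1)) (zeroʳ _)) ⟩
    (δ₁ ^S k) (n −1) * δ₁ 1ℤ  ≈⟨ *-cong (δ₁-^S k (n −1)) (δ-refl 1ℤ) ⟩
    δ (n −1) (+ k) * 1#       ≈⟨ *-identityʳ _ ⟩
    δ (n −1) (+ k)            ≈⟨ δ-resp (λ n−1≡k → P.trans (P.sym ([i−1]+1≡i n)) (P.trans (P.cong _+1 n−1≡k) (ℤP.+-comm (+ k) 1ℤ)))
                                        (λ n≡1+k → P.trans (P.cong _−1 (P.trans n≡1+k (ℤP.+-comm 1ℤ (+ k)))) ([i+1]−1≡i (+ k))) ⟩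
    δ n (+ suc k)             ∎
  ... | inj₂ n<1 = ≈-trans
    (rangeSum-zero {0ℤ} n _ (λ i _ i≤n → ≈-trans (*-congˡ (δ₁-order≥1 i (ℤP.≤-<-trans i≤n n<1))) (zeroʳ _)))
    (≈-sym (δ-≢ (λ n≡1+k → ℤP.<-irrefl P.refl (ℤP.<-≤-trans n<1 (ℤP.≤-trans (ℤ.+≤+ (ℕ.s≤s ℕ.z≤n)) (ℤP.≤-reflexive (P.sym n≡1+k)))))))

  ∘S-δ₁ : ∀ ψ n → 0ℤ ℤ.≤ n → (ψ ∘S δ₁) n ≈ ψ n
  ∘S-δ₁ ψ n 0≤n = begin
    rangeSum 0ℤ n (λ k → ψ k * (δ₁ ^S ℤ.∣ k ∣) n)
      ≈⟨ rangeSum-cong-range n (λ k 0≤k _ → *-congˡ (≈-trans (δ₁-^S ℤ.∣ k ∣ n) (reflexive (P.cong (δ n) (ℤP.0≤i⇒+∣i∣≡i 0≤k))))) ⟩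
    rangeSum 0ℤ n (λ k → ψ k * δ n k)
      ≈⟨ rangeSum-point n n _ 0≤n ℤP.≤-refl (λ k _ _ k≢n → ≈-trans (*-congˡ (δ-≢ (λ n≡k → k≢n (P.sym n≡k)))) (zeroʳ _)) ⟩
    ψ n * δ n n  ≈⟨ *-congˡ (δ-refl n) ⟩
    ψ n * 1#     ≈⟨ *-identityʳ _ ⟩
    ψ n          ∎

  matrixOf≈powerSeries-D : ∀ {z} ψ → matrixOf ψ ≈M[ z ] powerSeries ψ Dmatrix
  matrixOf≈powerSeries-D ψ =
    ≈M.trans (matrixOf-cong ψ (ψ ∘S δ₁) (λ n 0≤n → ≈-sym (∘S-δ₁ ψ n 0≤n))) (matrixOf-∘S ψ δ₁)

  ∘S-order≥1 : ∀ ψ φ → Order≥1 ψ → Order≥1 (ψ ∘S φ)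
  ∘S-order≥1 ψ φ ψ-order n n<1 =
    rangeSum-zero n _ (λ k _ k≤n → ≈-trans (*-congʳ (ψ-order k (ℤP.≤-<-trans k≤n n<1))) (zeroˡ _))

  ∘S-leading : ∀ ψ φ → Order≥1 ψ → Order≥1 φ → (ψ ∘S φ) 1ℤ ≈ ψ 1ℤ * φ 1ℤ
  ∘S-leading ψ φ ψ-order φ-order = begin
    rangeSum 0ℤ 1ℤ (λ k → ψ k * (φ ^S ℤ.∣ k ∣) 1ℤ)
      ≈⟨ rangeSum-point 1ℤ 1ℤ _ (ℤP.<⇒≤ 0<1) ℤP.≤-refl
           (λ k _ k≤1 k≢1 → ≈-trans (*-congʳ (ψ-order k (ℤP.≤∧≢⇒< k≤1 k≢1))) (zeroˡ ((φ ^S ℤ.∣ k ∣) 1ℤ))) ⟩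
    ψ 1ℤ * (φ ^S 1) 1ℤ ≈⟨ *-congˡ (≈-trans (^S-leading φ φ-order 1) (*-identityʳ _)) ⟩
    ψ 1ℤ * φ 1ℤ        ∎

  -- Column c of A is the series f^c; a left inverse of A, read off in column 1, gives the
  -- coefficients of the compositional inverse f̄, since then Σ_k f̄_k f^k = D.
  module CompositionalInverse (f : Series) (f-order : Order≥1 f) (f₁≉0 : f 1ℤ ≉ 0#) where

    A : Matrix
    A b c = (f ^S ℤ.∣ c ∣) b

    A-diag : ∀ c → Active true c → A c c ≉ 0#
    A-diag c 0≤c = ≉0-resp (≈-trans (≈-sym (^S-leading f f-order ℤ.∣ c ∣))
                                     (reflexive (P.cong (f ^S ℤ.∣ c ∣) (ℤP.0≤i⇒+∣i∣≡i 0≤c))))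
                           (^-nonzero ℤ.∣ c ∣ f₁≉0)

    open LeftInverse true A A-diag

    A·leftInverse : A · leftInverse ≈M[ true ] 1M
    A·leftInverse = ·-cancelʳ true A (A · leftInverse) 1M A-diag (λ b c zc c≤b → begin
      (A · leftInverse · A) b c    ≈⟨ ·-assoc A leftInverse A b c zc c≤b ⟩
      (A · (leftInverse · A)) b c  ≈⟨ ·-cong (≈M.refl {x = A}) leftInverse-· b c zc c≤b ⟩
      (A · 1M) b c                 ≈⟨ ·-identityʳ-entry A b c c≤b ⟩
      A b c                        ≈⟨ ·-identityˡ-entry A b c c≤b ⟨
      (1M · A) b c                 ∎)

    f̄ : Series
    f̄ k = if does (1ℤ ℤP.≤? k) then leftInverse k 1ℤ else 0#

    f̄-order≥1 : Order≥1 f̄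
    f̄-order≥1 k k<1 rewrite dec-false (1ℤ ℤP.≤? k) (ℤP.<⇒≱ k<1) = ≈-refl

    f̄-positive : ∀ k → 1ℤ ℤ.≤ k → f̄ k ≈ leftInverse k 1ℤ
    f̄-positive k 1≤k rewrite dec-true (1ℤ ℤP.≤? k) 1≤k = ≈-refl

    f̄₁≉0 : f̄ 1ℤ ≉ 0#
    f̄₁≉0 = ≉0-resp (≈-sym (f̄-positive 1ℤ ℤP.≤-refl)) (invertible⇒nonzeroˡ (begin
      leftInverse 1ℤ 1ℤ * A 1ℤ 1ℤ                    ≈⟨ rangeSum-single 1ℤ (λ j → leftInverse 1ℤ j * A j 1ℤ) ⟨
      (leftInverse · A) 1ℤ 1ℤ                        ≈⟨ leftInverse-· 1ℤ 1ℤ (ℤP.<⇒≤ 0<1) ℤP.≤-refl ⟩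
      1M 1ℤ 1ℤ                                       ≈⟨ δ-refl 1ℤ ⟩
      1#                                             ∎))

    f̄∘S-f : ∀ n → 0ℤ ℤ.≤ n → (f̄ ∘S f) n ≈ δ₁ n
    f̄∘S-f n 0≤n with ≤-or-> 1ℤ n
    ... | inj₁ 1≤n = begin
      rangeSum 0ℤ n (λ k → f̄ k * (f ^S ℤ.∣ k ∣) n)
        ≈⟨ rangeSum-uncons n _ 0≤n ⟩
      f̄ 0ℤ * (f ^S 0) n + rangeSum 1ℤ n (λ k → f̄ k * (f ^S ℤ.∣ k ∣) n)
        ≈⟨ +-cong (≈-trans (*-congʳ (f̄-order≥1 0ℤ 0<1)) (zeroˡ _))
                  (rangeSum-cong-range n (λ k 1≤k _ → ≈-trans (*-congʳ (f̄-positive k 1≤k)) (*-comm _ _))) ⟩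
      0# + (A · leftInverse) n 1ℤ  ≈⟨ +-identityˡ _ ⟩
      (A · leftInverse) n 1ℤ       ≈⟨ A·leftInverse n 1ℤ (ℤP.<⇒≤ 0<1) 1≤n ⟩
      δ 1ℤ n                       ≈⟨ δ-resp {1ℤ} {n} P.sym P.sym ⟩
      δ₁ n                         ∎
    ... | inj₂ n<1 = ≈-trans (∘S-order≥1 f̄ f f̄-order≥1 n n<1) (≈-sym (δ₁-order≥1 n n<1))

  allZero-sound : ∀ n f → allZero n f ≡ true → ∀ i → i ℕ.< n → f i ≡ 0ℤ
  allZero-sound (suc n) f all≡true i i<1+n with f n in fn≡
  ... | + zero with ℕP.m≤n⇒m<n∨m≡n (ℕP.≤-pred i<1+n)
  ...   | inj₁ i<n   = allZero-sound n f all≡true i i<n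
  ...   | inj₂ P.refl = fn≡
  allZero-sound (suc n) f () i i<1+n | + suc _
  allZero-sound (suc n) f () i i<1+n | -[1+ _ ]

  data ZeroView (α : LogIndex) : Bool → Set where
    zeroIndex    : IsZeroIdx α → ZeroView α true
    nonzeroIndex : ¬ IsZeroIdx α → ZeroView α false

  zeroView : ∀ α → ZeroView α (isZeroB α)
  zeroView α with isZeroB α in z≡
  ... | true  = zeroIndex (λ i → sound i (i ℕ.<? supp α))
    where
    sound : ∀ i → Dec (i ℕ.< supp α) → idx α i ≡ 0ℤ
    sound i (yes i<supp) = allZero-sound (supp α) (idx α) z≡ i i<supp
    sound i (no i≮supp)  = finSupp α i (ℕP.≮⇒≥ i≮supp)
  ... | false = nonzeroIndex (λ α≡0 → case (P.trans (P.sym z≡) (isZeroB-true α α≡0)))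
    where
    case : false ≡ true → ⊥
    case ()

  ActiveIn : LogIndex → ℤ → Set
  ActiveIn α = Active (isZeroB α)

  active-nonzeroIdx : ∀ α c → ¬ IsZeroIdx α → ActiveIn α c
  active-nonzeroIdx α c α≢0 with isZeroB α | zeroView α
  ... | true  | zeroIndex α≡0 = ⊥-elim (α≢0 α≡0)
  ... | false | nonzeroIndex _ = tt

  inactive-coef : ∀ {α} (s : Ser α) b → ¬ ActiveIn α b → coef s b ≈ 0#
  inactive-coef {α} s b inactive with isZeroB α | zeroView α
  ... | true  | zeroIndex α≡0 = zeroNeg s α≡0 b (ℤP.≰⇒> inactive)
  ... | false | nonzeroIndex _ = ⊥-elim (inactive tt)

  ≈S-active : ∀ {α} (s t : Ser α) → (∀ c → ActiveIn α c → coef s c ≈ coef t c) → s ≈S t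
  ≈S-active {α} s t s≈t c with active? (isZeroB α) c
  ... | yes active   = s≈t c active
  ... | no inactive  = ≈-trans (inactive-coef s c inactive) (≈-sym (inactive-coef t c inactive))

  mkSer-active : ∀ α N g b → b ℤ.≤ N → ActiveIn α b → coef (mkSer α N g) b ≈ g b
  mkSer-active α N g b b≤N active rewrite dec-true (b ℤP.≤? N) b≤N = kept (isZeroB α) active
    where
    kept : ∀ z → Active z b → sel (not (z ∧ does (b ℤP.<? 0ℤ))) (g b) ≈ g b
    kept false _ = ≈-refl
    kept true 0≤b rewrite dec-false (b ℤP.<? 0ℤ) (ℤP.≤⇒≯ 0≤b) = ≈-refl

  mkSer-coef : ∀ α N g → (∀ b → N ℤ.< b → g b ≈ 0#) → (∀ b → ¬ ActiveIn α b → g b ≈ 0#) →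
    ∀ b → coef (mkSer α N g) b ≈ g b
  mkSer-coef α N g g-above g-inactive b with ≤-or-> b N | active? (isZeroB α) b
  ... | inj₂ N<b | _            = ≈-trans (vanish (mkSer α N g) b N<b) (≈-sym (g-above b N<b))
  ... | inj₁ b≤N | yes active   = mkSer-active α N g b b≤N active
  ... | inj₁ _   | no inactive  = ≈-trans (inactive-coef (mkSer α N g) b inactive) (≈-sym (g-inactive b inactive))

  coef-+S : ∀ {α} (s t : Ser α) b → coef (s +S t) b ≈ coef s b + coef t b
  coef-+S {α} s t = mkSer-coef α _ _
    (λ b N<b → ≈-trans (+-cong (vanish s b (ℤP.≤-<-trans (ℤP.i≤i⊔j _ _) N<b)) (vanish t b (ℤP.≤-<-trans (ℤP.i≤j⊔i _ _) N<b)))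
                       (+-identityʳ 0#))
    (λ b inactive → ≈-trans (+-cong (inactive-coef s b inactive) (inactive-coef t b inactive)) (+-identityʳ 0#))

  coef-·S : ∀ {α} k (s : Ser α) b → coef (k ·S s) b ≈ k * coef s b
  coef-·S {α} k s = mkSer-coef α _ _
    (λ b N<b → ≈-trans (*-congˡ (vanish s b N<b)) (zeroʳ k))
    (λ b inactive → ≈-trans (*-congˡ (inactive-coef s b inactive)) (zeroʳ k))

  coef-λ : ∀ a α b → ActiveIn α b → coef λ[ a , α ] b ≈ δ b a
  coef-λ a α b active with ≤-or-> b a
  ... | inj₁ b≤a = mkSer-active α a (λ b′ → δ b′ a) b b≤a active
  ... | inj₂ a<b = ≈-trans (vanish λ[ a , α ] b a<b) (≈-sym (δ-≢ (λ b≡a → ℤP.<-irrefl (P.sym b≡a) a<b)))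

  act-coef : ∀ {α} (f : Delta) (s : Ser α) c → ActiveIn α c →
    coef (act (op f) s) c ≈ rangeSum c (bound s) (λ b → coef s b * matrixOf (dcoef (op f)) b c)
  act-coef {α} f s c active with ≤-or-> c (bound s ℤ.- low (op f))
  ... | inj₁ c≤N−low = begin
    coef (act (op f) s) c                    ≈⟨ mkSer-active α _ row c c≤N−low active ⟩
    rangeSum (low (op f)) (N ℤ.- c) h        ≈⟨ from-zero ⟩
    rangeSum 0ℤ (N ℤ.- c) h                  ≈⟨ rangeSum-cong (N ℤ.- c) h≈g ⟩
    rangeSum 0ℤ (N ℤ.- c) (λ a → g (c ℤ.+ a)) ≈⟨ rangeSum-shift (N ℤ.- c) c g ⟩
    rangeSum (c ℤ.+ 0ℤ) (c ℤ.+ (N ℤ.- c)) g  ≡⟨ P.cong₂ (λ lo hi → rangeSum lo hi g) (ℤP.+-identityʳ c) (i+[j−i]≡j c N) ⟩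
    rangeSum c N g                           ∎
    where
    N : ℤ
    N = bound s
    φ : Series
    φ = dcoef (op f)
    g : ℤ → Carrier
    g b = coef s b * matrixOf φ b c
    h : ℤ → Carrier
    h a = φ a * (coef s (c ℤ.+ a) * ratio (c ℤ.+ a) a)
    row : ℤ → Carrier
    row c′ = rangeSum (low (op f)) (N ℤ.- c′) (λ a → φ a * (coef s (c′ ℤ.+ a) * ratio (c′ ℤ.+ a) a))
    h≈g : ∀ a → h a ≈ g (c ℤ.+ a)
    h≈g a = ≈-trans (x∙yz≈y∙xz _ _ _)
      (reflexive (P.cong (λ x → coef s (c ℤ.+ a) * (φ x * ratio (c ℤ.+ a) x)) (P.sym ([i+j]−i≡j c a))))
    from-zero : rangeSum (low (op f)) (N ℤ.- c) h ≈ rangeSum 0ℤ (N ℤ.- c) h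
    from-zero with ℤP.≤-total (low (op f)) 0ℤ
    ... | inj₁ low≤0 = rangeSum-extendˡ (N ℤ.- c) h low≤0
      (λ a _ a<0 _ → ≈-trans (*-congʳ (deg≥1 f a (ℤP.<-trans a<0 0<1))) (zeroˡ _))
    ... | inj₂ 0≤low = ≈-sym (rangeSum-extendˡ (N ℤ.- c) h 0≤low
      (λ a _ a<low _ → ≈-trans (*-congʳ (below (op f) a a<low)) (zeroˡ _)))
  ... | inj₂ N−low<c = ≈-trans (vanish (act (op f) s) c N−low<c) (≈-sym (rangeSum-zero (bound s) _ (λ b _ b≤N →
    ≈-trans (*-congˡ (≈-trans (*-congʳ (below (op f) (b ℤ.- c) (b−c<low b≤N))) (zeroˡ _))) (zeroʳ _))))
    where
    b−c<low : ∀ {b} → b ℤ.≤ bound s → b ℤ.- c ℤ.< low (op f)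
    b−c<low {b} b≤N = ℤP.≤-<-trans (ℤP.+-monoˡ-≤ (ℤ.- c) b≤N) (i−j<k⇒i−k<j (bound s) (low (op f)) c N−low<c)

  rowsOf : ∀ {α} → (ℤ → Ser α) → Matrix
  rowsOf B b c = coef (B b) c

  LowerTriangular : ∀ {α} → (ℤ → Ser α) → Set ℓ
  LowerTriangular B = ∀ b c → b ℤ.< c → coef (B b) c ≈ 0#

  -- A continuous linear operator is determined by its values on a triangular basis (B b):
  -- s = Σ_b e_b B_b with e = (row of s) · L, the partial sums over b ≥ N − n converge to s,
  -- and continuity carries this expansion through τ.
  module Expansion (τ : Op) (τ-linear : Linear τ) (τ-continuous : Continuous τ) {α : LogIndex}
    (B : ℤ → Ser α) (B-lower : LowerTriangular B) (τB-lower : LowerTriangular (λ b → τ α (B b)))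
    (L : Matrix) (L·B≈1 : L · rowsOf B ≈M[ isZeroB α ] 1M) (s : Ser α) where

    private
      N : ℤ
      N = bound s
      row : Matrix
      row _ j = coef s j
      e : ℤ → Carrier
      e b = (row · L) N b
      N−n≤N : ∀ n → N ℤ.- + n ℤ.≤ N
      N−n≤N n = ℤP.i-j≤i N (+ n)
      N−n≤c : ∀ {c} n → c ℤ.≤ N → ℤ.∣ N ℤ.- c ∣ ℕ.≤ n → N ℤ.- + n ℤ.≤ c
      N−n≤c {c} n c≤N ∣N−c∣≤n = P.subst (N ℤ.- + n ℤ.≤_) (i−[i−j]≡j N c)
        (ℤP.+-monoʳ-≤ N (ℤP.neg-mono-≤ (P.subst (ℤ._≤ + n) (ℤP.0≤i⇒+∣i∣≡i (ℤP.i≤j⇒0≤j-i c≤N)) (ℤ.+≤+ ∣N−c∣≤n))))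
      N−[1+n]+1≡N−n : ∀ n → N ℤ.- + suc n +1 ≡ N ℤ.- + n
      N−[1+n]+1≡N−n n = P.trans (P.cong (λ x → N ℤ.- x +1) (ℤP.+-comm 1ℤ (+ n))) ([i−[j+1]]+1≡i−j N (+ n))

    term : ℕ → Ser α
    term n = e (N ℤ.- + n) ·S B (N ℤ.- + n)

    partialSum : ℕ → Ser α
    partialSum zero    = e N ·S B N
    partialSum (suc n) = partialSum n +S term (suc n)

    partialSum-like-coef : (W : ℤ → Ser α) (v : ℕ → Ser α) → (∀ c → coef (v 0) c ≈ e N * coef (W N) c) →
      (∀ n c → coef (v (suc n)) c ≈ coef (v n) c + e (N ℤ.- + suc n) * coef (W (N ℤ.- + suc n)) c) →
      ∀ n c → coef (v n) c ≈ rangeSum (N ℤ.- + n) N (λ b → e b * coef (W b) c)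
    partialSum-like-coef W v v0 vsuc zero c = begin
      coef (v 0) c                                    ≈⟨ v0 c ⟩
      e N * coef (W N) c                              ≈⟨ rangeSum-single N _ ⟨
      rangeSum N N (λ b → e b * coef (W b) c)         ≡⟨ P.cong (λ x → rangeSum x N (λ b → e b * coef (W b) c)) (ℤP.+-identityʳ N) ⟨
      rangeSum (N ℤ.- + 0) N (λ b → e b * coef (W b) c) ∎
    partialSum-like-coef W v v0 vsuc (suc n) c = begin
      coef (v (suc n)) c
        ≈⟨ vsuc n c ⟩
      coef (v n) c + t
        ≈⟨ ≈-trans (+-congʳ (partialSum-like-coef W v v0 vsuc n c)) (+-comm _ _) ⟩
      t + rangeSum (N ℤ.- + n) N (λ b → e b * coef (W b) c)
        ≡⟨ P.cong (λ x → t + rangeSum x N (λ b → e b * coef (W b) c)) (N−[1+n]+1≡N−n n) ⟨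
      t + rangeSum (N ℤ.- + suc n +1) N (λ b → e b * coef (W b) c)
        ≈⟨ rangeSum-uncons N _ (N−n≤N (suc n)) ⟨
      rangeSum (N ℤ.- + suc n) N (λ b → e b * coef (W b) c)
        ∎
      where
      t : Carrier
      t = e (N ℤ.- + suc n) * coef (W (N ℤ.- + suc n)) c

    tail-from : (W : ℤ → Ser α) → LowerTriangular W → ∀ n c → N ℤ.- + n ℤ.≤ c →
      rangeSum (N ℤ.- + n) N (λ b → e b * coef (W b) c) ≈ rangeSum c N (λ b → e b * coef (W b) c)
    tail-from W W-lower n c N−n≤c = rangeSum-extendˡ N _ N−n≤c (λ b _ b<c _ → ≈-trans (*-congˡ (W-lower b c b<c)) (zeroʳ _))

    tail-above : (W : ℤ → Ser α) → LowerTriangular W → ∀ n c → N ℤ.< c →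
      rangeSum (N ℤ.- + n) N (λ b → e b * coef (W b) c) ≈ 0#
    tail-above W W-lower n c N<c = rangeSum-zero N _ (λ b _ b≤N → ≈-trans (*-congˡ (W-lower b c (ℤP.≤-<-trans b≤N N<c))) (zeroʳ _))

    coordinates : ∀ c → ActiveIn α c → c ℤ.≤ N → rangeSum c N (λ b → e b * rowsOf B b c) ≈ coef s c
    coordinates c active c≤N = begin
      ((row · L) · rowsOf B) N c  ≈⟨ ·-assoc-entry row L (rowsOf B) N c ⟩
      (row · (L · rowsOf B)) N c  ≈⟨ ·-cong (≈M.refl {x = row}) L·B≈1 N c active c≤N ⟩
      (row · 1M) N c              ≈⟨ ·-identityʳ-entry row N c c≤N ⟩
      coef s c                    ∎

    partialSum-coef : ∀ n c → coef (partialSum n) c ≈ rangeSum (N ℤ.- + n) N (λ b → e b * rowsOf B b c)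
    partialSum-coef = partialSum-like-coef B partialSum (coef-·S (e N) (B N)) (λ n c →
      ≈-trans (coef-+S (partialSum n) (term (suc n)) c) (+-congˡ (coef-·S (e (N ℤ.- + suc n)) (B (N ℤ.- + suc n)) c)))

    τ-partialSum-coef : ∀ n c → coef (τ α (partialSum n)) c ≈ rangeSum (N ℤ.- + n) N (λ b → e b * coef (τ α (B b)) c)
    τ-partialSum-coef = partialSum-like-coef (λ b → τ α (B b)) (λ n → τ α (partialSum n))
      (λ c → ≈-trans (homogeneous (e N) (B N) c) (coef-·S (e N) (τ α (B N)) c))
      (λ n c → ≈-trans (additive (partialSum n) (term (suc n)) c) (≈-trans (coef-+S (τ α (partialSum n)) (τ α (term (suc n))) c)
                 (+-congˡ (≈-trans (homogeneous (e (N ℤ.- + suc n)) (B (N ℤ.- + suc n)) c)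
                                   (coef-·S (e (N ℤ.- + suc n)) (τ α (B (N ℤ.- + suc n))) c)))))
      where
      additive : ∀ s t → τ α (s +S t) ≈S (τ α s +S τ α t)
      additive = proj₁ (proj₂ (τ-linear α))
      homogeneous : ∀ k s → τ α (k ·S s) ≈S (k ·S τ α s)
      homogeneous = proj₂ (proj₂ (τ-linear α))

    partialSum-converges : Converges partialSum s
    partialSum-converges = (N , λ n b N<b → ≈-trans (partialSum-coef n b) (tail-above B B-lower n b N<b)) ,
      (λ b → ℤ.∣ N ℤ.- b ∣ , λ n n₀≤n → limit b n n₀≤n (active? (isZeroB α) b) (≤-or-> b N))
      where
      limit : ∀ b n → ℤ.∣ N ℤ.- b ∣ ℕ.≤ n → Dec (ActiveIn α b) → b ℤ.≤ N ⊎ N ℤ.< b → coef (partialSum n) b ≈ coef s b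
      limit b n n₀≤n (yes active) (inj₁ b≤N) =
        ≈-trans (partialSum-coef n b) (≈-trans (tail-from B B-lower n b (N−n≤c n b≤N n₀≤n)) (coordinates b active b≤N))
      limit b n _ _ (inj₂ N<b) =
        ≈-trans (partialSum-coef n b) (≈-trans (tail-above B B-lower n b N<b) (≈-sym (vanish s b N<b)))
      limit b n _ (no inactive) _ = ≈-trans (inactive-coef (partialSum n) b inactive) (≈-sym (inactive-coef s b inactive))

    transform-coef : ∀ c → coef (τ α s) c ≈ rangeSum c N (λ b → coef s b * (L · rowsOf (λ b → τ α (B b))) b c)
    transform-coef c = begin
      coef (τ α s) c
        ≈⟨ proj₂ (proj₂ τu→τs c) n (ℕP.m≤n⊔m n₀ n₁) ⟨
      coef (τ α (partialSum n)) c
        ≈⟨ τ-partialSum-coef n c ⟩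
      rangeSum (N ℤ.- + n) N (λ b → e b * TB b c)
        ≈⟨ truncate (≤-or-> c N) ⟩
      ((row · L) · TB) N c
        ≈⟨ ·-assoc-entry row L TB N c ⟩
      (row · (L · TB)) N c
        ∎
      where
      TB : Matrix
      TB = rowsOf (λ b → τ α (B b))
      τu→τs : Converges (λ n → τ α (partialSum n)) (τ α s)
      τu→τs = τ-continuous α partialSum s partialSum-converges
      n₀ n₁ n : ℕ
      n₀ = ℤ.∣ N ℤ.- c ∣
      n₁ = proj₁ (proj₂ τu→τs c)
      n = n₀ ℕ.⊔ n₁
      truncate : c ℤ.≤ N ⊎ N ℤ.< c → rangeSum (N ℤ.- + n) N (λ b → e b * TB b c) ≈ rangeSum c N (λ b → e b * TB b c)
      truncate (inj₁ c≤N) = tail-from (λ b → τ α (B b)) τB-lower n c (N−n≤c n c≤N (ℕP.m≤m⊔n n₀ n₁))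
      truncate (inj₂ N<c) = ≈-trans (tail-above (λ b → τ α (B b)) τB-lower n c N<c) (≈-sym (rangeSum-empty _ N<c))

  module _ (f : Delta) where

    private
      Fm : Matrix
      Fm = matrixOf (dcoef (op f))

    act-cong : ∀ {α} (s t : Ser α) → s ≈S t → act (op f) s ≈S act (op f) t
    act-cong {α} s t s≈t = ≈S-active (act (op f) s) (act (op f) t) λ c active → begin
      coef (act (op f) s) c                          ≈⟨ act-coef f s c active ⟩
      rangeSum c (bound s) (λ b → coef s b * Fm b c)  ≈⟨ rangeSum-cong (bound s) (λ b → *-congʳ (s≈t b)) ⟩
      rangeSum c (bound s) (λ b → coef t b * Fm b c)  ≈⟨ rangeSum-past-support (bound s) (bound t) (coef t) (λ b → Fm b c)
                                                           (λ j N<j → ≈-trans (≈-sym (s≈t j)) (vanish s j N<j)) (vanish t) ⟩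
      rangeSum c (bound t) (λ b → coef t b * Fm b c)  ≈⟨ act-coef f t c active ⟨
      coef (act (op f) t) c                          ∎

    act-·S : ∀ {α} k (s : Ser α) → act (op f) (k ·S s) ≈S (k ·S act (op f) s)
    act-·S {α} k s = ≈S-active (act (op f) (k ·S s)) (k ·S act (op f) s) λ c active → begin
      coef (act (op f) (k ·S s)) c                         ≈⟨ act-coef f (k ·S s) c active ⟩
      rangeSum c (bound s) (λ b → coef (k ·S s) b * Fm b c) ≈⟨ rangeSum-cong (bound s) (λ b → ≈-trans (*-congʳ (coef-·S k s b)) (*-assoc _ _ _)) ⟩
      rangeSum c (bound s) (λ b → k * (coef s b * Fm b c))  ≈⟨ rangeSum-*ˡ (bound s) k _ ⟨
      k * rangeSum c (bound s) (λ b → coef s b * Fm b c)    ≈⟨ *-congˡ (act-coef f s c active) ⟨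
      k * coef (act (op f) s) c                            ≈⟨ coef-·S k (act (op f) s) c ⟨
      coef (k ·S act (op f) s) c                           ∎

    iterate : ∀ {α} → ℕ → Ser α → Ser α
    iterate zero    s = s
    iterate (suc k) s = act (op f) (iterate k s)

    iterate-coef : ∀ {α} k (s : Ser α) c → ActiveIn α c → coef (iterate k s) c ≈ (rowsOf (λ _ → s) · Fm ^M k) (bound s) c
    iterate-coef zero s c _ with ≤-or-> c (bound s)
    ... | inj₁ c≤N = ≈-sym (·-identityʳ-entry (rowsOf (λ _ → s)) (bound s) c c≤N)
    ... | inj₂ N<c = ≈-trans (vanish s c N<c) (≈-sym (rangeSum-empty _ N<c))
    iterate-coef {α} (suc k) s c active = begin
      coef (act (op f) (iterate k s)) c
        ≈⟨ act-coef f (iterate k s) c active ⟩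
      rangeSum c (bound (iterate k s)) (λ j → coef (iterate k s) j * Fm j c)
        ≈⟨ rangeSum-past-support (bound (iterate k s)) (bound s) (coef (iterate k s)) (λ j → Fm j c) (vanish (iterate k s)) vanish-above ⟩
      rangeSum c (bound s) (λ j → coef (iterate k s) j * Fm j c)
        ≈⟨ rangeSum-cong-range (bound s) (λ j c≤j _ → *-congʳ (iterate-coef k s j (active-mono (isZeroB α) active c≤j))) ⟩
      (rowsOf (λ _ → s) · Fm ^M k · Fm) (bound s) c
        ≈⟨ ·-assoc-entry (rowsOf (λ _ → s)) (Fm ^M k) Fm (bound s) c ⟩
      (rowsOf (λ _ → s) · Fm ^M suc k) (bound s) c
        ∎
      where
      vanish-above : ∀ j → bound s ℤ.< j → coef (iterate k s) j ≈ 0#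
      vanish-above j N<j with active? (isZeroB α) j
      ... | yes active-j = ≈-trans (iterate-coef k s j active-j) (rangeSum-empty _ N<j)
      ... | no inactive  = inactive-coef (iterate k s) j inactive

    -- For α with IsZeroIdx α the grading axioms say nothing about p_b^α; its triangularity is
    -- recovered from ⟨α ∣ f(D)^m p_b⟩ = (⌊b⌉!/⌊b−m⌉!)·[b = m], as column 0 of F^m vanishes
    -- above row m and is nonzero in row m.
    module ZeroIndex (p : GSeq) (α : LogIndex) (α≡0 : IsZeroIdx α)
      (p-act : ∀ a → act (op f) (p a α) ≈S (fromℤ ⌊ a ⌉ ·S p (a −1) α))
      (p-one : ⟨ α ∣ p 0ℤ α ⟩ ≈ 1#) (p-zero : ∀ a → ¬ (a ≡ 0ℤ) → ⟨ α ∣ p a α ⟩ ≈ 0#) where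

      iterate-p : ∀ m b c → coef (iterate m (p b α)) c ≈ ratio b (+ m) * coef (p (b ℤ.- + m) α) c
      iterate-p zero b c rewrite ℤP.+-identityʳ b = ≈-sym (≈-trans (*-congʳ (fact*invFact b)) (*-identityˡ _))
      iterate-p (suc m) b c = begin
        coef (act (op f) (iterate m (p b α))) c
          ≈⟨ act-cong (iterate m (p b α)) (r ·S p (b ℤ.- + m) α)
               (λ c′ → ≈-trans (iterate-p m b c′) (≈-sym (coef-·S r (p (b ℤ.- + m) α) c′))) c ⟩
        coef (act (op f) (r ·S p (b ℤ.- + m) α)) c
          ≈⟨ ≈-trans (act-·S r (p (b ℤ.- + m) α) c) (coef-·S r (act (op f) (p (b ℤ.- + m) α)) c) ⟩
        r * coef (act (op f) (p (b ℤ.- + m) α)) c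
          ≈⟨ *-congˡ (≈-trans (p-act (b ℤ.- + m) c) (coef-·S _ (p (b ℤ.- + m −1) α) c)) ⟩
        r * (fromℤ ⌊ b ℤ.- + m ⌉ * coef (p (b ℤ.- + m −1) α) c)
          ≈⟨ *-assoc _ _ _ ⟨
        (r * fromℤ ⌊ b ℤ.- + m ⌉) * coef (p (b ℤ.- + m −1) α) c
          ≈⟨ *-cong (ratio-suc b m) (reflexive (P.cong (λ x → coef (p x α) c) (i−n−1≡i−[1+n] b m))) ⟩
        ratio b (+ suc m) * coef (p (b ℤ.- + suc m) α) c
          ∎
        where
        r : Carrier
        r = ratio b (+ m)

      Fm^m-vanish : ∀ m j → j ℤ.< + m → (Fm ^M m) j 0ℤ ≈ 0#
      Fm^m-vanish m j j<m = ^M-vanish (matrixOf-strictlyLower {false} _ (deg≥1 f)) m j 0ℤ tt j<m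

      Fm^m-corner : ∀ m → (Fm ^M m) (+ m) 0ℤ ≉ 0#
      Fm^m-corner m = ≉0-resp (matrixOf-^S {false} (dcoef (op f)) m (+ m) 0ℤ tt (ℤ.+≤+ ℕ.z≤n))
        (≉0-resp (reflexive (P.cong (λ n → (dcoef (op f) ^S m) n * ratio (+ m) n) (P.sym (ℤP.+-identityʳ (+ m)))))
          (≉0-resp (≈-sym (*-congʳ (^S-leading (dcoef (op f)) (deg≥1 f) m)))
            (*-nonzero (^-nonzero m (c₁≠0 f)) (ratio-nonzero (+ m) (+ m)))))

      column0 : ∀ b m → (∀ j → + m ℤ.< j → coef (p b α) j ≈ 0#) →
        coef (p b α) (+ m) * (Fm ^M m) (+ m) 0ℤ ≈ ratio b (+ m) * ⟨ α ∣ p (b ℤ.- + m) α ⟩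
      column0 b m p-above = ≈-trans (pick (≤-or-> (+ m) N)) (≈-trans (≈-sym (iterate-coef m s 0ℤ (active-0 _))) (iterate-p m b 0ℤ))
        where
        s : Ser α
        s = p b α
        N : ℤ
        N = bound s
        pick : + m ℤ.≤ N ⊎ N ℤ.< + m → coef s (+ m) * (Fm ^M m) (+ m) 0ℤ ≈ rangeSum 0ℤ N (λ j → coef s j * (Fm ^M m) j 0ℤ)
        pick (inj₁ m≤N) = ≈-sym (rangeSum-point N (+ m) _ (ℤ.+≤+ ℕ.z≤n) m≤N (λ j _ _ j≢m → term j j≢m (≤-or-> j (+ m))))
          where
          term : ∀ j → j ≢ + m → j ℤ.≤ + m ⊎ + m ℤ.< j → coef s j * (Fm ^M m) j 0ℤ ≈ 0#
          term j j≢m (inj₁ j≤m) = ≈-trans (*-congˡ (Fm^m-vanish m j (ℤP.≤∧≢⇒< j≤m j≢m))) (zeroʳ _)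
          term j _   (inj₂ m<j) = ≈-trans (*-congʳ (p-above j m<j)) (zeroˡ _)
        pick (inj₂ N<m) = ≈-trans (≈-trans (*-congʳ (vanish s (+ m) N<m)) (zeroˡ _))
          (≈-sym (rangeSum-zero N _ (λ j _ j≤N → ≈-trans (*-congˡ (Fm^m-vanish m j (ℤP.≤-<-trans j≤N N<m))) (zeroʳ _))))

      above-diagonal : ∀ b c → b ℤ.< c → coef (p b α) c ≈ 0#
      above-diagonal b c b<c with ≤-or-> c (bound (p b α) +1)
      ... | inj₁ c≤N+1 = ≥-induction (N +1) Q (λ j N+1≤j _ → vanish s j (ℤP.<-≤-trans (i<i+1 N) N+1≤j)) step c c≤N+1 c ℤP.≤-refl b<c
        where
        s : Ser α
        s = p b α
        N : ℤ
        N = bound s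
        Q : ℤ → Set ℓ
        Q k = ∀ j → k ℤ.≤ j → b ℤ.< j → coef s j ≈ 0#
        diagonal-step : ∀ k → b ℤ.< k → Q (k +1) → coef s k ≈ 0#
        diagonal-step k b<k ih with ≤-or-> 0ℤ k
        ... | inj₂ k<0 = zeroNeg s α≡0 k k<0
        ... | inj₁ 0≤k with above 0≤k
        ...   | lo+ m = nonzero-cancelʳ (Fm^m-corner m) (begin
          coef s (+ m) * (Fm ^M m) (+ m) 0ℤ      ≈⟨ column0 b m (λ j m<j → ih j (<⇒+1≤ m<j) (ℤP.<-trans b<k m<j)) ⟩
          ratio b (+ m) * ⟨ α ∣ p (b ℤ.- + m) α ⟩ ≈⟨ *-congˡ (p-zero _ (λ b−m≡0 → ℤP.<-irrefl (ℤP.i-j≡0⇒i≡j b (+ m) b−m≡0) b<k)) ⟩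
          ratio b (+ m) * 0#                      ≈⟨ zeroʳ _ ⟩
          0#                                      ∎)
        step : ∀ k → k ℤ.< N +1 → Q (k +1) → Q k
        step k _ ih j k≤j b<j with ≤-or-> (k +1) j
        ... | inj₁ k+1≤j = ih j k+1≤j b<j
        ... | inj₂ j<k+1 rewrite ℤP.≤-antisym (<+1⇒≤ j<k+1) k≤j = diagonal-step k b<j ih
      ... | inj₂ N+1<c = vanish (p b α) c (ℤP.<-trans (i<i+1 (bound (p b α))) N+1<c)

      diagonal : ∀ c → 0ℤ ℤ.≤ c → coef (p c α) c ≉ 0#
      diagonal c 0≤c with above 0≤c
      ... | lo+ m = λ pcc≈0 → ratio-nonzero (+ m) (+ m) (begin
        ratio (+ m) (+ m)                                    ≈⟨ *-identityʳ _ ⟨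
        ratio (+ m) (+ m) * 1#                               ≈⟨ *-congˡ (≈-trans (reflexive (P.cong (λ x → ⟨ α ∣ p x α ⟩) (ℤP.+-inverseʳ (+ m)))) p-one) ⟨
        ratio (+ m) (+ m) * ⟨ α ∣ p (+ m ℤ.- + m) α ⟩        ≈⟨ column0 (+ m) m (λ j m<j → above-diagonal (+ m) j m<j) ⟨
        coef (p (+ m) α) (+ m) * (Fm ^M m) (+ m) 0ℤ          ≈⟨ ≈-trans (*-congʳ pcc≈0) (zeroˡ _) ⟩
        0#                                                   ∎)

  ·-column0 : ∀ L X j → 0ℤ ℤ.≤ j → (∀ i → X i 0ℤ ≈ 1M i 0ℤ) → (L · X) j 0ℤ ≈ L j 0ℤ
  ·-column0 L X j 0≤j X-col0 = begin
    rangeSum 0ℤ j (λ i → L j i * X i 0ℤ) ≈⟨ rangeSum-cong j (λ i → *-congˡ (X-col0 i)) ⟩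
    (L · 1M) j 0ℤ                        ≈⟨ ·-identityʳ-entry L j 0ℤ 0≤j ⟩
    L j 0ℤ                               ∎

  seqMatrix : GSeq → LogIndex → Matrix
  seqMatrix p α = rowsOf (λ b → p b α)

  seqMatrix-regular : ∀ {p} → IsGraded p → ∀ α β → ¬ IsZeroIdx α → ¬ IsZeroIdx β →
    seqMatrix p α ≈M[ false ] seqMatrix p β
  seqMatrix-regular (_ , _ , regular , _) α β α≢0 β≢0 b c _ _ = regular b α β α≢0 β≢0 c

  seqMatrix-regular₀ : ∀ {p} → IsGraded p → seqMatrix p zeroIdx ≈M[ true ] seqMatrix p oneIdx
  seqMatrix-regular₀ (_ , _ , _ , regular₀) b c 0≤c _ = regular₀ b c 0≤c

  module Associated (f : Delta) (p : GSeq) (p-assoc : IsAssociated f p) where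

    private
      p-graded : IsGraded p
      p-graded = proj₁ p-assoc
      p-one : ∀ α → ⟨ α ∣ p 0ℤ α ⟩ ≈ 1#
      p-one = proj₁ (proj₂ p-assoc)
      p-zero : ∀ a α → ¬ (a ≡ 0ℤ) → ⟨ α ∣ p a α ⟩ ≈ 0#
      p-zero = proj₁ (proj₂ (proj₂ p-assoc))
      p-act : ∀ a α → act (op f) (p a α) ≈S (fromℤ ⌊ a ⌉ ·S p (a −1) α)
      p-act = proj₂ (proj₂ (proj₂ p-assoc))

    Pm : LogIndex → Matrix
    Pm = seqMatrix p

    Fm : Matrix
    Fm = matrixOf (dcoef (op f))

    Fm-strictlyLower : ∀ {z} → StrictlyLower z Fm
    Fm-strictlyLower = matrixOf-strictlyLower _ (deg≥1 f)

    P-lower : ∀ α → LowerTriangular (λ b → p b α)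
    P-lower α with isZeroB α | zeroView α
    ... | true  | zeroIndex α≡0   = ZeroIndex.above-diagonal f p α α≡0 (λ a → p-act a α) (p-one α) (λ a → p-zero a α)
    ... | false | nonzeroIndex α≢0 = λ b c b<c → proj₁ (proj₂ p-graded) b α α≢0 c b<c

    P-diag : ∀ α c → ActiveIn α c → Pm α c c ≉ 0#
    P-diag α c with isZeroB α | zeroView α
    ... | true  | zeroIndex α≡0   = ZeroIndex.diagonal f p α α≡0 (λ a → p-act a α) (p-one α) (λ a → p-zero a α) c
    ... | false | nonzeroIndex α≢0 = λ _ → proj₁ p-graded c α α≢0

    P-column0 : ∀ α j → Pm α j 0ℤ ≈ 1M j 0ℤ
    P-column0 α j with j ℤP.≟ 0ℤ
    ... | yes P.refl = ≈-trans (p-one α) (≈-sym (δ-refl 0ℤ))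
    ... | no j≢0     = ≈-trans (p-zero j α j≢0) (≈-sym (δ-≢ (λ 0≡j → j≢0 (P.sym 0≡j))))

    P·F≈D·P : ∀ α → Pm α · Fm ≈M[ isZeroB α ] Dmatrix · Pm α
    P·F≈D·P α b c active c≤b = begin
      rangeSum c b (λ j → Pm α b j * Fm j c)             ≈⟨ rangeSum-past-support b (bound (p b α)) (Pm α b) (λ j → Fm j c)
                                                             (P-lower α b) (vanish (p b α)) ⟩
      rangeSum c (bound (p b α)) (λ j → Pm α b j * Fm j c) ≈⟨ act-coef f (p b α) c active ⟨
      coef (act (op f) (p b α)) c                         ≈⟨ p-act b α c ⟩
      coef (fromℤ ⌊ b ⌉ ·S p (b −1) α) c                  ≈⟨ coef-·S _ (p (b −1) α) c ⟩
      fromℤ ⌊ b ⌉ * Pm α (b −1) c                         ≈⟨ Dmatrix-· (Pm α) b c c≤b (P-lower α (b −1) c) ⟨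
      (Dmatrix · Pm α) b c                                ∎

    Lm : LogIndex → Matrix
    Lm α = LeftInverse.leftInverse (isZeroB α) (Pm α) (P-diag α)

    L·P≈1 : ∀ α → Lm α · Pm α ≈M[ isZeroB α ] 1M
    L·P≈1 α = LeftInverse.leftInverse-· (isZeroB α) (Pm α) (P-diag α)

    L·D≈F·L : ∀ α → Lm α · Dmatrix ≈M[ isZeroB α ] Fm · Lm α
    L·D≈F·L α = ·-cancelʳ (isZeroB α) (Pm α) (Lm α · Dmatrix) (Fm · Lm α) (P-diag α) λ b c active c≤b → begin
      (Lm α · Dmatrix · Pm α) b c    ≈⟨ ·-assoc-entry (Lm α) Dmatrix (Pm α) b c ⟩
      (Lm α · (Dmatrix · Pm α)) b c  ≈⟨ ·-cong (≈M.refl {x = Lm α}) (P·F≈D·P α) b c active c≤b ⟨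
      (Lm α · (Pm α · Fm)) b c       ≈⟨ ·-assoc-entry (Lm α) (Pm α) Fm b c ⟨
      (Lm α · Pm α · Fm) b c         ≈⟨ ·-cong (L·P≈1 α) (≈M.refl {x = Fm}) b c active c≤b ⟩
      (1M · Fm) b c                  ≈⟨ ·-identityˡ-entry Fm b c c≤b ⟩
      Fm b c                         ≈⟨ ·-identityʳ-entry Fm b c c≤b ⟨
      (Fm · 1M) b c                  ≈⟨ ·-cong (≈M.refl {x = Fm}) (L·P≈1 α) b c active c≤b ⟨
      (Fm · (Lm α · Pm α)) b c       ≈⟨ ·-assoc-entry Fm (Lm α) (Pm α) b c ⟨
      (Fm · Lm α · Pm α) b c         ∎

    L-diag : ∀ α a → ActiveIn α a → Lm α a a ≉ 0#
    L-diag α a active = invertible⇒nonzeroˡ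
      (≈-trans (≈-sym (rangeSum-single a (λ j → Lm α a j * Pm α j a))) (≈-trans (L·P≈1 α a a active ℤP.≤-refl) (δ-refl a)))

    L-regular : ∀ α β → ¬ IsZeroIdx α → ¬ IsZeroIdx β → Lm α ≈M[ false ] Lm β
    L-regular α β α≢0 β≢0 = ·-cancelʳ false (Pm α) (Lm α) (Lm β) (λ c _ → P-diag α c (active-nonzeroIdx α c α≢0)) λ b c _ c≤b → begin
      (Lm α · Pm α) b c  ≈⟨ L·P≈1 α b c (active-nonzeroIdx α c α≢0) c≤b ⟩
      1M b c             ≈⟨ L·P≈1 β b c (active-nonzeroIdx β c β≢0) c≤b ⟨
      (Lm β · Pm β) b c  ≈⟨ ·-cong (≈M.refl {x = Lm β}) (seqMatrix-regular {p} p-graded β α β≢0 α≢0) b c tt c≤b ⟩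
      (Lm β · Pm α) b c  ∎

    L-regular₀ : Lm zeroIdx ≈M[ true ] Lm oneIdx
    L-regular₀ = ·-cancelʳ true (Pm zeroIdx) (Lm zeroIdx) (Lm oneIdx) (P-diag zeroIdx) λ b c 0≤c c≤b → begin
      (Lm zeroIdx · Pm zeroIdx) b c ≈⟨ L·P≈1 zeroIdx b c 0≤c c≤b ⟩
      1M b c                        ≈⟨ L·P≈1 oneIdx b c tt c≤b ⟨
      (Lm oneIdx · Pm oneIdx) b c   ≈⟨ ·-cong (≈M.refl {x = Lm oneIdx}) (≈M.sym (seqMatrix-regular₀ {p} p-graded)) b c 0≤c c≤b ⟩
      (Lm oneIdx · Pm zeroIdx) b c  ∎

  -- Taking the coefficient matrix of r in product form makes it lower triangular for free,
  -- since (A · B) b c sums over c ≤ j ≤ b only.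
  module FromMatrices (r : GSeq) (A B : LogIndex → Matrix)
    (r-coef : ∀ α a c → ActiveIn α c → coef (r a α) c ≈ (A α · B α) a c) where

    r-lower : ∀ α → LowerTriangular (λ a → r a α)
    r-lower α a c a<c with active? (isZeroB α) c
    ... | yes active  = ≈-trans (r-coef α a c active) (rangeSum-empty _ a<c)
    ... | no inactive = inactive-coef (r a α) c inactive

    graded : (∀ α a → ¬ IsZeroIdx α → A α a a * B α a a ≉ 0#) →
      (∀ α β → ¬ IsZeroIdx α → ¬ IsZeroIdx β → A α · B α ≈M[ false ] A β · B β) →
      A zeroIdx · B zeroIdx ≈M[ true ] A oneIdx · B oneIdx → IsGraded r
    graded diag regular regular₀ = degree , (λ a α _ → r-lower α a) , regular-coef , regular₀-coef
      where
      degree : ∀ a α → ¬ IsZeroIdx α → coef (r a α) a ≉ 0#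
      degree a α α≢0 = ≉0-resp (≈-sym (≈-trans (r-coef α a a (active-nonzeroIdx α a α≢0)) (rangeSum-single a _)))
                               (diag α a α≢0)
      regular-coef : ∀ a α β → ¬ IsZeroIdx α → ¬ IsZeroIdx β → ∀ b → coef (r a α) b ≈ coef (r a β) b
      regular-coef a α β α≢0 β≢0 b with ≤-or-> b a
      ... | inj₁ b≤a = begin
        coef (r a α) b   ≈⟨ r-coef α a b (active-nonzeroIdx α b α≢0) ⟩
        (A α · B α) a b  ≈⟨ regular α β α≢0 β≢0 a b tt b≤a ⟩
        (A β · B β) a b  ≈⟨ r-coef β a b (active-nonzeroIdx β b β≢0) ⟨
        coef (r a β) b   ∎
      ... | inj₂ a<b = ≈-trans (r-lower α a b a<b) (≈-sym (r-lower β a b a<b))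
      regular₀-coef : ∀ a b → 0ℤ ℤ.≤ b → coef (r a zeroIdx) b ≈ coef (r a oneIdx) b
      regular₀-coef a b 0≤b with ≤-or-> b a
      ... | inj₁ b≤a = begin
        coef (r a zeroIdx) b           ≈⟨ r-coef zeroIdx a b 0≤b ⟩
        (A zeroIdx · B zeroIdx) a b    ≈⟨ regular₀ a b 0≤b b≤a ⟩
        (A oneIdx · B oneIdx) a b      ≈⟨ r-coef oneIdx a b tt ⟨
        coef (r a oneIdx) b            ∎
      ... | inj₂ a<b = ≈-trans (r-lower zeroIdx a b a<b) (≈-sym (r-lower oneIdx a b a<b))

    associated : (h : Delta) →
      (∀ α → A α · B α · matrixOf (dcoef (op h)) ≈M[ isZeroB α ] Dmatrix · (A α · B α)) →
      (∀ α j → (A α · B α) j 0ℤ ≈ 1M j 0ℤ) → IsGraded r → IsAssociated h r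
    associated h intertwine column0 r-graded =
        r-graded
      , (λ α → ≈-trans (r-coef α 0ℤ 0ℤ (active-0 _)) (≈-trans (column0 α 0ℤ) (δ-refl 0ℤ)))
      , (λ a α a≢0 → ≈-trans (r-coef α a 0ℤ (active-0 _)) (≈-trans (column0 α a) (δ-≢ (λ 0≡a → a≢0 (P.sym 0≡a)))))
      , act-r
      where
      Hm : Matrix
      Hm = matrixOf (dcoef (op h))
      act-r : ∀ a α → act (op h) (r a α) ≈S (fromℤ ⌊ a ⌉ ·S r (a −1) α)
      act-r a α = ≈S-active (act (op h) (r a α)) (fromℤ ⌊ a ⌉ ·S r (a −1) α) λ c active → begin
        coef (act (op h) (r a α)) c                            ≈⟨ act-coef h (r a α) c active ⟩
        rangeSum c (bound (r a α)) (λ b → coef (r a α) b * Hm b c) ≈⟨ rangeSum-past-support _ a _ _ (vanish (r a α)) (r-lower α a) ⟩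
        rangeSum c a (λ b → coef (r a α) b * Hm b c)            ≈⟨ by-row c active (≤-or-> c a) ⟩
        fromℤ ⌊ a ⌉ * coef (r (a −1) α) c                       ≈⟨ coef-·S _ (r (a −1) α) c ⟨
        coef (fromℤ ⌊ a ⌉ ·S r (a −1) α) c                      ∎
        where
        by-row : ∀ c → ActiveIn α c → c ℤ.≤ a ⊎ a ℤ.< c →
          rangeSum c a (λ b → coef (r a α) b * Hm b c) ≈ fromℤ ⌊ a ⌉ * coef (r (a −1) α) c
        by-row c active (inj₁ c≤a) = begin
          rangeSum c a (λ b → coef (r a α) b * Hm b c) ≈⟨ rangeSum-cong-range a (λ b c≤b _ → *-congʳ (r-coef α a b (active-mono _ active c≤b))) ⟩
          (A α · B α · Hm) a c                         ≈⟨ intertwine α a c active c≤a ⟩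
          (Dmatrix · (A α · B α)) a c                  ≈⟨ Dmatrix-· (A α · B α) a c c≤a (λ a−1<c → rangeSum-empty _ a−1<c) ⟩
          fromℤ ⌊ a ⌉ * (A α · B α) (a −1) c           ≈⟨ *-congˡ (r-coef α (a −1) c active) ⟨
          fromℤ ⌊ a ⌉ * coef (r (a −1) α) c            ∎
        by-row c _ (inj₂ a<c) = begin
          rangeSum c a (λ b → coef (r a α) b * Hm b c) ≈⟨ rangeSum-empty _ a<c ⟩
          0#                                           ≈⟨ zeroʳ _ ⟨
          fromℤ ⌊ a ⌉ * 0#                             ≈⟨ *-congˡ (r-lower α (a −1) c (ℤP.<-trans (i−1<i a) a<c)) ⟨
          fromℤ ⌊ a ⌉ * coef (r (a −1) α) c            ∎

  -- Transfer and umbral operators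

  deltaOperator : (φ : Series) → Order≥1 φ → φ 1ℤ ≉ 0# → Delta
  deltaOperator φ φ-order φ₁≉0 = record
    { op    = record { dcoef = φ ; low = 1ℤ ; below = φ-order }
    ; deg≥1 = φ-order
    ; c₁≠0  = φ₁≉0
    }

  _∘Δ_ : Delta → Delta → Delta
  g ∘Δ f = deltaOperator (dcoef (op g) ∘S dcoef (op f)) (∘S-order≥1 _ _ (deg≥1 g))
    (≉0-resp (≈-sym (∘S-leading _ _ (deg≥1 g) (deg≥1 f))) (*-nonzero (c₁≠0 g) (c₁≠0 f)))

  Dmatrix-strictlyLower : ∀ {z} → StrictlyLower z Dmatrix
  Dmatrix-strictlyLower = matrixOf-strictlyLower δ₁ δ₁-order≥1

  transfer-coef : ∀ f p τ → IsAssociated f p → IsTransferOf p τ → ∀ α (s : Ser α) c →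
    coef (τ α s) c ≈ rangeSum c (bound s) (λ b → coef s b * seqMatrix p α b c)
  transfer-coef f p τ p-assoc (τ-continuous , τ-linear , τλ≈p) α s c = begin
    coef (τ α s) c
      ≈⟨ Expansion.transform-coef τ τ-linear τ-continuous (λ b → λ[ b , α ]) (λ b c → vanish λ[ b , α ] c)
           (λ b c b<c → ≈-trans (τλ≈p b α c) (P-lower α b c b<c)) 1M
           (λ b c active c≤b → ≈-trans (·-identityˡ-entry (rowsOf (λ b → λ[ b , α ])) b c c≤b) (coef-λ b α c active)) s c ⟩
    rangeSum c (bound s) (λ b → coef s b * (1M · rowsOf (λ b → τ α λ[ b , α ])) b c)
      ≈⟨ rangeSum-cong-range (bound s) (λ b c≤b _ → *-congˡ (≈-trans (·-identityˡ-entry (rowsOf (λ b → τ α λ[ b , α ])) b c c≤b) (τλ≈p b α c))) ⟩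
    rangeSum c (bound s) (λ b → coef s b * seqMatrix p α b c)
      ∎
    where open Associated f p p-assoc

  transfer-preserves-Roman : (p q : GSeq) (τ : Op) → Roman p → IsTransferOf p τ → Roman q →
    Roman (λ a α → τ α (q a α))
  transfer-preserves-Roman p q τ (f , p-assoc) τ-transfer (g , q-assoc) =
    g ∘Δ f , associated (g ∘Δ f) intertwine column0 (graded diag regular regular₀)
    where
    module Ap = Associated f p p-assoc
    module Aq = Associated g q q-assoc
    r : GSeq
    r a α = τ α (q a α)

    r-coef : ∀ α a c → ActiveIn α c → coef (r a α) c ≈ (Aq.Pm α · Ap.Pm α) a c
    r-coef α a c _ = ≈-trans (transfer-coef f p τ p-assoc τ-transfer α (q a α) c)
      (rangeSum-past-support (bound (q a α)) a (Aq.Pm α a) (λ b → Ap.Pm α b c) (vanish (q a α)) (Aq.P-lower α a))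

    open FromMatrices r Aq.Pm Ap.Pm r-coef

    Hm : Matrix
    Hm = matrixOf (dcoef (op (g ∘Δ f)))

    P·H≈G·P : ∀ α → Ap.Pm α · Hm ≈M[ isZeroB α ] Aq.Fm · Ap.Pm α
    P·H≈G·P α b c active c≤b = begin
      (Ap.Pm α · Hm) b c
        ≈⟨ ·-cong (≈M.refl {x = Ap.Pm α}) (matrixOf-∘S (dcoef (op g)) (dcoef (op f))) b c active c≤b ⟩
      (Ap.Pm α · powerSeries (dcoef (op g)) Ap.Fm) b c
        ≈⟨ powerSeries-intertwine (Ap.Pm α) Ap.Fm Dmatrix Ap.Fm-strictlyLower Dmatrix-strictlyLower
             (Ap.P·F≈D·P α) (dcoef (op g)) b c active c≤b ⟩
      (powerSeries (dcoef (op g)) Dmatrix · Ap.Pm α) b c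
        ≈⟨ ·-cong (matrixOf≈powerSeries-D (dcoef (op g))) (≈M.refl {x = Ap.Pm α}) b c active c≤b ⟨
      (Aq.Fm · Ap.Pm α) b c
        ∎

    intertwine : ∀ α → Aq.Pm α · Ap.Pm α · Hm ≈M[ isZeroB α ] Dmatrix · (Aq.Pm α · Ap.Pm α)
    intertwine α b c active c≤b = begin
      (Aq.Pm α · Ap.Pm α · Hm) b c        ≈⟨ ·-assoc-entry (Aq.Pm α) (Ap.Pm α) Hm b c ⟩
      (Aq.Pm α · (Ap.Pm α · Hm)) b c      ≈⟨ ·-cong (≈M.refl {x = Aq.Pm α}) (P·H≈G·P α) b c active c≤b ⟩
      (Aq.Pm α · (Aq.Fm · Ap.Pm α)) b c   ≈⟨ ·-assoc-entry (Aq.Pm α) Aq.Fm (Ap.Pm α) b c ⟨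
      (Aq.Pm α · Aq.Fm · Ap.Pm α) b c     ≈⟨ ·-cong (Aq.P·F≈D·P α) (≈M.refl {x = Ap.Pm α}) b c active c≤b ⟩
      (Dmatrix · Aq.Pm α · Ap.Pm α) b c   ≈⟨ ·-assoc-entry Dmatrix (Aq.Pm α) (Ap.Pm α) b c ⟩
      (Dmatrix · (Aq.Pm α · Ap.Pm α)) b c ∎

    column0 : ∀ α j → (Aq.Pm α · Ap.Pm α) j 0ℤ ≈ 1M j 0ℤ
    column0 α j with ≤-or-> 0ℤ j
    ... | inj₁ 0≤j = ≈-trans (·-column0 (Aq.Pm α) (Ap.Pm α) j 0≤j (Ap.P-column0 α)) (Aq.P-column0 α j)
    ... | inj₂ j<0 = ≈-trans (rangeSum-empty _ j<0) (≈-sym (δ-≢ (λ 0≡j → ℤP.<-irrefl (P.sym 0≡j) j<0)))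

    diag : ∀ α a → ¬ IsZeroIdx α → Aq.Pm α a a * Ap.Pm α a a ≉ 0#
    diag α a α≢0 = *-nonzero (Aq.P-diag α a (active-nonzeroIdx α a α≢0)) (Ap.P-diag α a (active-nonzeroIdx α a α≢0))

    regular : ∀ α β → ¬ IsZeroIdx α → ¬ IsZeroIdx β → Aq.Pm α · Ap.Pm α ≈M[ false ] Aq.Pm β · Ap.Pm β
    regular α β α≢0 β≢0 = ·-cong (seqMatrix-regular {q} (proj₁ q-assoc) α β α≢0 β≢0) (seqMatrix-regular {p} (proj₁ p-assoc) α β α≢0 β≢0)

    regular₀ : Aq.Pm zeroIdx · Ap.Pm zeroIdx ≈M[ true ] Aq.Pm oneIdx · Ap.Pm oneIdx
    regular₀ = ·-cong (seqMatrix-regular₀ {q} (proj₁ q-assoc)) (seqMatrix-regular₀ {p} (proj₁ p-assoc))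

  inverseDelta : Delta → Delta
  inverseDelta f = deltaOperator f̄ f̄-order≥1 f̄₁≉0
    where open CompositionalInverse (dcoef (op f)) (deg≥1 f) (c₁≠0 f)

  module Umbral (f g : Delta) (p q : GSeq) (τ : Op) (p-assoc : IsAssociated f p) (q-assoc : IsAssociated g q)
    (τ-continuous : Continuous τ) (τ-linear : Linear τ) (τp≈q : ∀ a α → τ α (p a α) ≈S q a α) where

    module Ap = Associated f p p-assoc
    module Aq = Associated g q q-assoc

    Tm : LogIndex → Matrix
    Tm α = Ap.Lm α · Aq.Pm α

    τ-coef : ∀ α (s : Ser α) c → coef (τ α s) c ≈ rangeSum c (bound s) (λ b → coef s b * Tm α b c)
    τ-coef α s c = begin
      coef (τ α s) c
        ≈⟨ Expansion.transform-coef τ τ-linear τ-continuous (λ b → p b α) (Ap.P-lower α)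
             (λ b c b<c → ≈-trans (τp≈q b α c) (Aq.P-lower α b c b<c)) (Ap.Lm α) (Ap.L·P≈1 α) s c ⟩
      rangeSum c (bound s) (λ b → coef s b * (Ap.Lm α · rowsOf (λ b → τ α (p b α))) b c)
        ≈⟨ rangeSum-cong (bound s) (λ b → *-congˡ (rangeSum-cong b (λ j → *-congˡ (τp≈q j α c)))) ⟩
      rangeSum c (bound s) (λ b → coef s b * Tm α b c)
        ∎

    T·G≈F·T : ∀ α → Tm α · Aq.Fm ≈M[ isZeroB α ] Ap.Fm · Tm α
    T·G≈F·T α b c active c≤b = begin
      (Ap.Lm α · Aq.Pm α · Aq.Fm) b c     ≈⟨ ·-assoc-entry (Ap.Lm α) (Aq.Pm α) Aq.Fm b c ⟩
      (Ap.Lm α · (Aq.Pm α · Aq.Fm)) b c   ≈⟨ ·-cong (≈M.refl {x = Ap.Lm α}) (Aq.P·F≈D·P α) b c active c≤b ⟩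
      (Ap.Lm α · (Dmatrix · Aq.Pm α)) b c ≈⟨ ·-assoc-entry (Ap.Lm α) Dmatrix (Aq.Pm α) b c ⟨
      (Ap.Lm α · Dmatrix · Aq.Pm α) b c   ≈⟨ ·-cong (Ap.L·D≈F·L α) (≈M.refl {x = Aq.Pm α}) b c active c≤b ⟩
      (Ap.Fm · Ap.Lm α · Aq.Pm α) b c     ≈⟨ ·-assoc-entry Ap.Fm (Ap.Lm α) (Aq.Pm α) b c ⟩
      (Ap.Fm · (Ap.Lm α · Aq.Pm α)) b c   ∎

    T-column0 : ∀ α j → Tm α j 0ℤ ≈ 1M j 0ℤ
    T-column0 α j with ≤-or-> 0ℤ j
    ... | inj₁ 0≤j = begin
      (Ap.Lm α · Aq.Pm α) j 0ℤ  ≈⟨ ·-column0 (Ap.Lm α) (Aq.Pm α) j 0≤j (Aq.P-column0 α) ⟩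
      Ap.Lm α j 0ℤ              ≈⟨ ·-column0 (Ap.Lm α) (Ap.Pm α) j 0≤j (Ap.P-column0 α) ⟨
      (Ap.Lm α · Ap.Pm α) j 0ℤ  ≈⟨ Ap.L·P≈1 α j 0ℤ (active-0 _) 0≤j ⟩
      1M j 0ℤ                   ∎
    ... | inj₂ j<0 = ≈-trans (rangeSum-empty _ j<0) (≈-sym (δ-≢ (λ 0≡j → ℤP.<-irrefl (P.sym 0≡j) j<0)))

    -- ⟨α ∣ g(D) τ s⟩ = (s · T · G)₀ = (s · F · T)₀ = (s · F)₀ = ⟨α ∣ f(D) s⟩, as column 0 of T is that of 1M.
    adjoint : AdjointIs τ (op g) (op f)
    adjoint α α≢0 s = begin
      coef (act (op f) s) 0ℤ                                 ≈⟨ act-coef f s 0ℤ active0 ⟩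
      rangeSum 0ℤ N (λ b → coef s b * Ap.Fm b 0ℤ)             ≈⟨ pairing (≤-or-> 0ℤ N) ⟨
      rangeSum 0ℤ N (λ j → coef (τ α s) j * Aq.Fm j 0ℤ)       ≈⟨ rangeSum-past-support N (bound (τ α s)) (coef (τ α s)) (λ j → Aq.Fm j 0ℤ)
                                                                   τs-above (vanish (τ α s)) ⟩
      rangeSum 0ℤ (bound (τ α s)) (λ j → coef (τ α s) j * Aq.Fm j 0ℤ) ≈⟨ act-coef g (τ α s) 0ℤ active0 ⟨
      coef (act (op g) (τ α s)) 0ℤ                           ∎
      where
      N : ℤ
      N = bound s
      active0 : ActiveIn α 0ℤ
      active0 = active-0 (isZeroB α)
      row : Matrix
      row _ j = coef s j
      τs-above : ∀ j → N ℤ.< j → coef (τ α s) j ≈ 0#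
      τs-above j N<j = ≈-trans (τ-coef α s j) (rangeSum-empty _ N<j)
      pairing : 0ℤ ℤ.≤ N ⊎ N ℤ.< 0ℤ →
        rangeSum 0ℤ N (λ j → coef (τ α s) j * Aq.Fm j 0ℤ) ≈ rangeSum 0ℤ N (λ b → coef s b * Ap.Fm b 0ℤ)
      pairing (inj₁ 0≤N) = begin
        rangeSum 0ℤ N (λ j → coef (τ α s) j * Aq.Fm j 0ℤ) ≈⟨ rangeSum-cong N (λ j → *-congʳ (τ-coef α s j)) ⟩
        (row · Tm α · Aq.Fm) N 0ℤ                     ≈⟨ ·-assoc-entry row (Tm α) Aq.Fm N 0ℤ ⟩
        (row · (Tm α · Aq.Fm)) N 0ℤ                   ≈⟨ ·-cong (≈M.refl {x = row}) (T·G≈F·T α) N 0ℤ active0 0≤N ⟩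
        (row · (Ap.Fm · Tm α)) N 0ℤ                   ≈⟨ ·-assoc-entry row Ap.Fm (Tm α) N 0ℤ ⟨
        (row · Ap.Fm · Tm α) N 0ℤ                     ≈⟨ ·-column0 (row · Ap.Fm) (Tm α) N 0≤N (T-column0 α) ⟩
        rangeSum 0ℤ N (λ b → coef s b * Ap.Fm b 0ℤ)   ∎
      pairing (inj₂ N<0) = ≈-trans (rangeSum-empty _ N<0) (≈-sym (rangeSum-empty _ N<0))

    r : GSeq
    r a α = τ α λ[ a , α ]

    r-coef : ∀ α a c → ActiveIn α c → coef (r a α) c ≈ (Ap.Lm α · Aq.Pm α) a c
    r-coef α a c active = ≈-trans (τ-coef α λ[ a , α ] c) (pick (≤-or-> c a))
      where
      pick : c ℤ.≤ a ⊎ a ℤ.< c → rangeSum c a (λ b → coef λ[ a , α ] b * Tm α b c) ≈ Tm α a c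
      pick (inj₁ c≤a) = begin
        rangeSum c a (λ b → coef λ[ a , α ] b * Tm α b c) ≈⟨ rangeSum-point a a _ c≤a ℤP.≤-refl (λ b c≤b _ b≢a →
            ≈-trans (*-congʳ (≈-trans (coef-λ a α b (active-mono _ active c≤b)) (δ-≢ b≢a))) (zeroˡ _)) ⟩
        coef λ[ a , α ] a * Tm α a c ≈⟨ *-congʳ (≈-trans (coef-λ a α a (active-mono _ active c≤a)) (δ-refl a)) ⟩
        1# * Tm α a c                ≈⟨ *-identityˡ _ ⟩
        Tm α a c                     ∎
      pick (inj₂ a<c) = ≈-trans (rangeSum-empty _ a<c) (≈-sym (rangeSum-empty _ a<c))

    open FromMatrices r Ap.Lm Aq.Pm r-coef

    h : Delta
    h = inverseDelta f ∘Δ g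

    intertwine : ∀ α → Tm α · matrixOf (dcoef (op h)) ≈M[ isZeroB α ] Dmatrix · Tm α
    intertwine α b c active c≤b = begin
      (Tm α · matrixOf (f̄ ∘S gs)) b c         ≈⟨ ·-cong (≈M.refl {x = Tm α}) (matrixOf-∘S f̄ gs) b c active c≤b ⟩
      (Tm α · powerSeries f̄ Aq.Fm) b c        ≈⟨ powerSeries-intertwine (Tm α) Aq.Fm Ap.Fm Aq.Fm-strictlyLower Ap.Fm-strictlyLower
                                                   (T·G≈F·T α) f̄ b c active c≤b ⟩
      (powerSeries f̄ Ap.Fm · Tm α) b c        ≈⟨ ·-cong (matrixOf-∘S f̄ fs) (≈M.refl {x = Tm α}) b c active c≤b ⟨
      (matrixOf (f̄ ∘S fs) · Tm α) b c         ≈⟨ ·-cong (matrixOf-cong (f̄ ∘S fs) δ₁ f̄∘S-f) (≈M.refl {x = Tm α}) b c active c≤b ⟩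
      (Dmatrix · Tm α) b c                    ∎
      where
      fs gs : Series
      fs = dcoef (op f)
      gs = dcoef (op g)
      open CompositionalInverse fs (deg≥1 f) (c₁≠0 f)

    diag : ∀ α a → ¬ IsZeroIdx α → Ap.Lm α a a * Aq.Pm α a a ≉ 0#
    diag α a α≢0 = *-nonzero (Ap.L-diag α a (active-nonzeroIdx α a α≢0)) (Aq.P-diag α a (active-nonzeroIdx α a α≢0))

    regular : ∀ α β → ¬ IsZeroIdx α → ¬ IsZeroIdx β → Tm α ≈M[ false ] Tm β
    regular α β α≢0 β≢0 = ·-cong (Ap.L-regular α β α≢0 β≢0) (seqMatrix-regular {q} (proj₁ q-assoc) α β α≢0 β≢0)

    regular₀ : Tm zeroIdx ≈M[ true ] Tm oneIdx
    regular₀ = ·-cong Ap.L-regular₀ (seqMatrix-regular₀ {q} (proj₁ q-assoc))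

    transfer : IsTransferOperator τ
    transfer = r , (h , associated h intertwine T-column0 (graded diag regular regular₀)) , (τ-continuous , τ-linear , λ _ _ _ → ≈-refl)

mainTheorem2 : ∀ {c ℓ} (F : Char0Field c ℓ) →
    let open Theory F in
    -- (1) transfer operators map Roman graded sequences to Roman graded sequences
      (∀ (p q : GSeq) (τ : Op) → Roman p → IsTransferOf p τ → Roman q →
         Roman (λ a α → τ α (q a α)))
    -- (2) τ* g(D) = f(D), and (3) τ is a transfer operator
    × (∀ (f g : Delta) (p q : GSeq) (τ : Op) →
         IsAssociated f p → IsAssociated g q →
         Continuous τ → Linear τ →
         (∀ a α → τ α (p a α) ≈S q a α) →
         AdjointIs τ (op g) (op f) × IsTransferOperator τ)
mainTheorem2 F = transfer-preserves-Roman F , λ f g p q τ p-assoc q-assoc τ-continuous τ-linear τp≈q →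
  let open Umbral F f g p q τ p-assoc q-assoc τ-continuous τ-linear τp≈q in adjoint , transfer
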